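{- Let $A\geq a\geq 1$ and $r\geq 1$ be integers. The generating function $\sum_\pi q^{|\pi|}$ over the overpartitions $\pi$ such that $\pi$ has at least one overlined part whose size is $\equiv a\pmod A$ and less than $mes_{r,A,a}(\pi)$ is \[\frac{(-q;q)_{\infty}}{(q;q)_{\infty}}\sum_{k=1}^{\infty}\frac{q^{r[A\binom{k}{2}+ka]}}{(-q^a;q^A)_k}.\]
   Context: An overpartition is a partition (finite non-increasing sequence of positive integers) in which the first occurrence of each part value may be overlined; $|\pi|$ is the sum of parts. A part is of size $t$ if it equals $t$ or $\overline{t}$. $(a;q)_\infty=\prod_{i\geq0}(1-aq^i)$, $(a;q)_n=(a;q)_\infty/(aq^n;q)_\infty$; $|q|<1$. For $r\geq1$, $mes_{r,A,a}(\pi)$ is the smallest positive integer $\equiv a\pmod A$ such that there are fewer than $r$ parts of size $mes_{r,A,a}(\pi)$ in $\pi$. -}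

module Defs where

open import Data.Nat using (ℕ; zero; suc; _+_; _*_; _∸_; _≤_; _<_; _≡ᵇ_; NonZero; _%_)
open import Data.Nat.Combinatorics using (_C_)
open import Data.Integer as ℤ using (ℤ; +_; -_)
open import Data.Bool using (Bool; true; false; if_then_else_)
open import Data.List using (List; []; _∷_; length; map)
open import Data.Nat.ListAction using (sum)
open import Data.Unit using (⊤)
open import Data.List.Membership.Propositional using (_∈_)
open import Data.Product using (_×_; _,_; proj₁; Σ; ∃)
open import Relation.Binary.PropositionalEquality using (_≡_)

-- Overpartitions
-- A part is a pair (size , overlined?).  An overpartition is a list of
-- parts, all of positive size, non-increasing in size, where among parts
-- of equal size only the first one may be overlined (canonical form of
-- "the first occurrence of each part value may be overlined").

Part : Set
Part = ℕ × Bool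

Ordered : List Part → Set
Ordered [] = ⊤
Ordered ((s , b) ∷ []) = ⊤
Ordered ((s , b) ∷ (s′ , b′) ∷ π) =
  (s′ ≤ s) × ((s′ ≡ s → b′ ≡ false) × Ordered ((s′ , b′) ∷ π))

Positive : List Part → Set
Positive [] = ⊤
Positive ((s , b) ∷ π) = (1 ≤ s) × Positive π

IsOverpartition : List Part → Set
IsOverpartition π = Positive π × Ordered π

weight : List Part → ℕ
weight π = sum (map proj₁ π)

countSize : ℕ → List Part → ℕ
countSize t [] = 0
countSize t ((s , b) ∷ π) = if s ≡ᵇ t then suc (countSize t π) else countSize t π

IsMes : (r A a : ℕ) .{{_ : NonZero A}} → List Part → ℕ → Set
IsMes r A a π m =
  (1 ≤ m) × (m % A ≡ a % A) × (countSize m π < r) ×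
  (∀ m′ → 1 ≤ m′ → m′ % A ≡ a % A → m′ < m → r ≤ countSize m′ π)

Condition : (r A a : ℕ) .{{_ : NonZero A}} → List Part → Set
Condition r A a π =
  ∃ λ m → IsMes r A a π m ×
    (∃ λ s → ((s , true) ∈ π) × (s % A ≡ a % A) × (s < m))

Series : Set
Series = ℕ → ℤ

sumTo : ℕ → (ℕ → ℤ) → ℤ
sumTo zero f = f 0
sumTo (suc n) f = sumTo n f ℤ.+ f (suc n)

sumFrom1To : ℕ → (ℕ → ℤ) → ℤ
sumFrom1To zero f = + 0
sumFrom1To (suc n) f = sumFrom1To n f ℤ.+ f (suc n)

one : Series
one n = if n ≡ᵇ 0 then + 1 else + 0

mono : ℕ → Series
mono e n = if n ≡ᵇ e then + 1 else + 0

_⊕_ : Series → Series → Series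
(f ⊕ g) n = f n ℤ.+ g n

_⊛_ : Series → Series → Series
(f ⊛ g) n = sumTo n (λ i → f i ℤ.* g (n ∸ i))

-- 1 / (1 - c q^m) = Σ_j c^j q^{mj}   (used only with m ≥ 1)
geomInv : ℤ → ℕ → Series
geomInv c m n = sumTo n (λ j → if (j * m) ≡ᵇ n then c ℤ.^ j else + 0)

prodFrom1To : ℕ → (ℕ → Series) → Series
prodFrom1To zero f = one
prodFrom1To (suc N) f = prodFrom1To N f ⊛ f (suc N)

prodBelow : ℕ → (ℕ → Series) → Series
prodBelow zero f = one
prodBelow (suc k) f = prodBelow k f ⊛ f k

-- (-q;q)_∞ / (q;q)_∞ = ∏_{i≥1} (1+q^i)/(1-q^i).  The factors with i > n
-- are ≡ 1 mod q^{n+1}, so the n-th coefficient of the infinite product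
-- is the n-th coefficient of the product over 1 ≤ i ≤ n.
overGF : Series
overGF n = prodFrom1To n (λ i → (one ⊕ mono i) ⊛ geomInv (+ 1) i) n

-- 1 / (-q^a;q^A)_k = ∏_{i=0}^{k-1} 1/(1 + q^{a+iA})
invPoch : (A a k : ℕ) → Series
invPoch A a k = prodBelow k (λ i → geomInv (- (+ 1)) (a + i * A))

summand : (r A a k : ℕ) → Series
summand r A a k = mono (r * (A * (k C 2) + k * a)) ⊛ invPoch A a k

-- Σ_{k≥1} summand k.  For a, r ≥ 1 the k-th summand has order ≥ k, so
-- the n-th coefficient is the n-th coefficient of the sum over 1 ≤ k ≤ n.
sumSeries : (r A a : ℕ) → Series
sumSeries r A a n = sumFrom1To n (λ k → summand r A a k n)

rhs : (r A a : ℕ) → Series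
rhs r A a = overGF ⊛ sumSeries r A a

module Submission where

-- An overpartition satisfies the condition for exactly one k ≥ 1: a + (k − 1)A is its smallest
-- overlined part of size ≡ a (mod A), and as it lies below mes, each size a + iA with i < k occurs
-- at least r times, overlined only for i = k − 1; conversely these requirements push mes beyond
-- a + (k − 1)A. Imposed size by size, they turn the factor (1 + q^s)/(1 − q^s) of (−q;q)_∞/(q;q)_∞
-- for s = a + iA into q^(rs)/(1 − q^s) = (1 + q^s)/(1 − q^s) · q^(rs)/(1 + q^s), so these
-- overpartitions are counted by the k-th summand. Coefficientwise this is checked by listing the
-- overpartitions of n block by block, one part size at a time, and counting the list.

open import Defs
open import Algebra.Bundles using (CommutativeMonoid)
open import Data.Bool using (Bool; true; false; if_then_else_; _∨_)
open import Data.Bool.Properties using (T-≡; ¬-not)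
import Data.Bool.Properties as Bool
open import Data.Integer using (ℤ; +_; 1ℤ; -1ℤ) renaming (_+_ to _+ᶻ_; _*_ to _*ᶻ_; _^_ to _^ᶻ_)
import Data.Integer.Properties as ℤ
open import Data.Integer.Tactic.RingSolver using (solve-∀)
open import Data.List using (List; []; _∷_; _++_; _∷ʳ_; map; length; replicate; concatMap; upTo)
import Data.List.Properties as List
open import Data.List.Membership.Propositional using (_∈_; find; lose)
open import Data.List.Membership.Propositional.Properties
  using (∈-concatMap⁺; ∈-concatMap⁻; ∈-map⁺; ∈-map⁻; ∈-upTo⁺; ∈-upTo⁻)
open import Data.List.Relation.Unary.All using (All; []; _∷_)
import Data.List.Relation.Unary.All as All
import Data.List.Relation.Unary.All.Properties as All
open import Data.List.Relation.Unary.Any using (here; there)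
open import Data.List.Relation.Unary.Unique.Propositional using (Unique; []; _∷_)
import Data.List.Relation.Unary.Unique.Propositional.Properties as Unique
open import Data.Nat
  using (ℕ; zero; suc; _+_; _*_; _∸_; _≤_; _<_; _≡ᵇ_; _≤ᵇ_; z≤n; s≤s; _%_; _/_; NonZero; >-nonZero; >-nonZero⁻¹)
open import Data.Nat.Combinatorics using (_C_; nC1≡n; nCk+nC[k+1]≡[n+1]C[k+1])
import Data.Nat.DivMod as DivMod
import Data.Nat.Properties as ℕ
open import Data.Nat.Tactic.RingSolver using () renaming (solve-∀ to ℕ-solve-∀)
open import Data.Product using (_,_; _×_; proj₁; proj₂; ∃)
open import Data.Sum using (inj₁; inj₂)
open import Data.Unit using (tt)
open import Function using (_∘_)
open import Function.Bundles using (Equivalence)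
open import Level using (0ℓ)
open import Relation.Binary.Definitions using (tri<; tri≈; tri>)
open import Relation.Binary.PropositionalEquality
import Relation.Binary.Reasoning.Setoid
open import Relation.Binary.Structures using (IsEquivalence)
open import Relation.Nullary using (¬_; yes; no; contradiction)
open import Relation.Unary using (Decidable)

open Equivalence using (to; from)

≡ᵇ-true : ∀ {m n} → m ≡ n → (m ≡ᵇ n) ≡ true
≡ᵇ-true {m} {n} = to T-≡ ∘ ℕ.≡⇒≡ᵇ m n

≡ᵇ-false : ∀ {m n} → m ≢ n → (m ≡ᵇ n) ≡ false
≡ᵇ-false {m} {n} m≢n = ¬-not (m≢n ∘ ℕ.≡ᵇ⇒≡ m n ∘ from T-≡)

≡ᵇ-true⁻ : ∀ {m n} → (m ≡ᵇ n) ≡ true → m ≡ n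
≡ᵇ-true⁻ {m} {n} = ℕ.≡ᵇ⇒≡ m n ∘ from T-≡

≤ᵇ-true : ∀ {m n} → m ≤ n → (m ≤ᵇ n) ≡ true
≤ᵇ-true = to T-≡ ∘ ℕ.≤⇒≤ᵇ

≤ᵇ-false : ∀ {m n} → ¬ m ≤ n → (m ≤ᵇ n) ≡ false
≤ᵇ-false {m} {n} m≰n = ¬-not (m≰n ∘ ℕ.≤ᵇ⇒≤ m n ∘ from T-≡)

≤ᵇ-true⁻ : ∀ {m n} → (m ≤ᵇ n) ≡ true → m ≤ n
≤ᵇ-true⁻ {m} {n} = ℕ.≤ᵇ⇒≤ m n ∘ from T-≡

iverson : Bool → ℤ
iverson b = if b then + 1 else + 0

if-else-0≡iverson-* : ∀ b x → (if b then x else + 0) ≡ iverson b *ᶻ x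
if-else-0≡iverson-* true x = sym (ℤ.*-identityˡ x)
if-else-0≡iverson-* false x = refl

δ : ℕ → ℕ → ℤ
δ i n = iverson (i ≡ᵇ n)

δ-≡ : ∀ {i n} → i ≡ n → δ i n ≡ + 1
δ-≡ i≡n rewrite ≡ᵇ-true i≡n = refl

δ-≢ : ∀ {i n} → i ≢ n → δ i n ≡ + 0
δ-≢ i≢n rewrite ≡ᵇ-false i≢n = refl

δ-≢-* : ∀ {i n} → i ≢ n → ∀ x → δ i n *ᶻ x ≡ + 0
δ-≢-* i≢n x rewrite δ-≢ i≢n = ℤ.*-zeroˡ x

δ-≡-* : ∀ {i n} → i ≡ n → ∀ x → δ i n *ᶻ x ≡ x
δ-≡-* i≡n x rewrite δ-≡ i≡n = ℤ.*-identityˡ x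

sumBelow : ℕ → (ℕ → ℤ) → ℤ
sumBelow zero f = + 0
sumBelow (suc n) f = sumBelow n f +ᶻ f n

sumTo≡sumBelow : ∀ n f → sumTo n f ≡ sumBelow (suc n) f
sumTo≡sumBelow zero f = sym (ℤ.+-identityˡ (f 0))
sumTo≡sumBelow (suc n) f = cong (_+ᶻ f (suc n)) (sumTo≡sumBelow n f)

sumFrom1To≡sumBelow : ∀ n f → sumFrom1To n f ≡ sumBelow n (f ∘ suc)
sumFrom1To≡sumBelow zero f = refl
sumFrom1To≡sumBelow (suc n) f = cong (_+ᶻ f (suc n)) (sumFrom1To≡sumBelow n f)

sumBelow-cong : ∀ n {f g} → (∀ i → i < n → f i ≡ g i) → sumBelow n f ≡ sumBelow n g
sumBelow-cong zero f≡g = refl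
sumBelow-cong (suc n) f≡g =
  cong₂ _+ᶻ_ (sumBelow-cong n (λ i i<n → f≡g i (ℕ.m<n⇒m<1+n i<n))) (f≡g n (ℕ.n<1+n n))

sumTo-cong : ∀ n {f g} → (∀ i → i ≤ n → f i ≡ g i) → sumTo n f ≡ sumTo n g
sumTo-cong n {f} {g} f≡g = begin
  sumTo n f              ≡⟨ sumTo≡sumBelow n f ⟩
  sumBelow (suc n) f     ≡⟨ sumBelow-cong (suc n) (λ i i<1+n → f≡g i (ℕ.≤-pred i<1+n)) ⟩
  sumBelow (suc n) g     ≡⟨ sumTo≡sumBelow n g ⟨
  sumTo n g              ∎
  where open ≡-Reasoning

sumBelow-zero : ∀ n {f} → (∀ i → i < n → f i ≡ + 0) → sumBelow n f ≡ + 0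
sumBelow-zero n {f} f≡0 = trans (sumBelow-cong n f≡0) (zeros n)
  where
  zeros : ∀ n → sumBelow n (λ _ → + 0) ≡ + 0
  zeros zero = refl
  zeros (suc n) = cong (_+ᶻ + 0) (zeros n)

sumBelow-extend : ∀ {n} N f → n ≤ N → (∀ i → n ≤ i → i < N → f i ≡ + 0) →
                  sumBelow N f ≡ sumBelow n f
sumBelow-extend zero f z≤n _ = refl
sumBelow-extend {n} (suc N) f n≤1+N f≡0 with ℕ.m≤n⇒m<n∨m≡n n≤1+N
... | inj₂ refl = refl
... | inj₁ n<1+N
  rewrite sumBelow-extend N f (ℕ.≤-pred n<1+N) (λ i n≤i i<N → f≡0 i n≤i (ℕ.m<n⇒m<1+n i<N))
        | f≡0 N (ℕ.≤-pred n<1+N) (ℕ.n<1+n N) = ℤ.+-identityʳ _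

sumBelow-single : ∀ N c f → c < N → (∀ i → i < N → i ≢ c → f i ≡ + 0) → sumBelow N f ≡ f c
sumBelow-single (suc N) c f c<1+N f≡0 with c ℕ.≟ N
... | yes refl
  rewrite sumBelow-zero N {f} (λ i i<N → f≡0 i (ℕ.m<n⇒m<1+n i<N) (ℕ.<⇒≢ i<N)) = ℤ.+-identityˡ _
... | no c≢N
  rewrite sumBelow-single N c f (ℕ.≤∧≢⇒< (ℕ.≤-pred c<1+N) c≢N) (λ i i<N → f≡0 i (ℕ.m<n⇒m<1+n i<N))
        | f≡0 N (ℕ.n<1+n N) (c≢N ∘ sym) = ℤ.+-identityʳ _

sumBelow-+ : ∀ n f g → sumBelow n (λ i → f i +ᶻ g i) ≡ sumBelow n f +ᶻ sumBelow n g
sumBelow-+ zero f g = refl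
sumBelow-+ (suc n) f g rewrite sumBelow-+ n f g = middleFour (sumBelow n f) (sumBelow n g) (f n) (g n)
  where
  middleFour : ∀ a b c d → (a +ᶻ b) +ᶻ (c +ᶻ d) ≡ (a +ᶻ c) +ᶻ (b +ᶻ d)
  middleFour = solve-∀

sumBelow-*ˡ : ∀ n c f → c *ᶻ sumBelow n f ≡ sumBelow n (λ i → c *ᶻ f i)
sumBelow-*ˡ zero c f = ℤ.*-zeroʳ c
sumBelow-*ˡ (suc n) c f rewrite sym (sumBelow-*ˡ n c f) = ℤ.*-distribˡ-+ c (sumBelow n f) (f n)

sumBelow-*ʳ : ∀ n c f → sumBelow n f *ᶻ c ≡ sumBelow n (λ i → f i *ᶻ c)
sumBelow-*ʳ n c f =
  trans (ℤ.*-comm (sumBelow n f) c) (trans (sumBelow-*ˡ n c f) (sumBelow-cong n (λ i _ → ℤ.*-comm c (f i))))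

sumBelow-swap : ∀ n m (F : ℕ → ℕ → ℤ) →
                sumBelow n (λ i → sumBelow m (F i)) ≡ sumBelow m (λ j → sumBelow n (λ i → F i j))
sumBelow-swap zero m F = sym (sumBelow-zero m (λ _ _ → refl))
sumBelow-swap (suc n) m F rewrite sumBelow-swap n m F = sym (sumBelow-+ m (λ j → sumBelow n (λ i → F i j)) (F n))

infix 4 _≈_
_≈_ : Series → Series → Set
f ≈ g = ∀ n → f n ≡ g n

sumBelow² : ℕ → (ℕ → ℕ → ℤ) → ℤ
sumBelow² N F = sumBelow N (λ i → sumBelow N (F i))

sumBelow³ : ℕ → (ℕ → ℕ → ℕ → ℤ) → ℤ
sumBelow³ N F = sumBelow N (λ i → sumBelow² N (F i))

sumBelow²-cong : ∀ N {F G} → (∀ i j → F i j ≡ G i j) → sumBelow² N F ≡ sumBelow² N G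
sumBelow²-cong N F≡G = sumBelow-cong N (λ i _ → sumBelow-cong N (λ j _ → F≡G i j))

sumBelow³-cong : ∀ N {F G} → (∀ i j l → F i j l ≡ G i j l) → sumBelow³ N F ≡ sumBelow³ N G
sumBelow³-cong N F≡G = sumBelow-cong N (λ i _ → sumBelow²-cong N (F≡G i))

sumBelow³-rotate : ∀ N F → sumBelow³ N F ≡ sumBelow³ N (λ j l i → F i j l)
sumBelow³-rotate N F =
  trans (sumBelow-swap N N _) (sumBelow-cong N (λ j _ → sumBelow-swap N N (λ i l → F i j l)))

sumBelow²-*-* : ∀ N c d F → c *ᶻ (sumBelow² N F *ᶻ d) ≡ sumBelow² N (λ i j → c *ᶻ (F i j *ᶻ d))
sumBelow²-*-* N c d F = begin
  c *ᶻ (sumBelow² N F *ᶻ d)                          ≡⟨ cong (c *ᶻ_) (sumBelow-*ʳ N d _) ⟩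
  c *ᶻ sumBelow N (λ i → sumBelow N (F i) *ᶻ d)      ≡⟨ sumBelow-*ˡ N c _ ⟩
  sumBelow N (λ i → c *ᶻ (sumBelow N (F i) *ᶻ d))    ≡⟨ sumBelow-cong N (λ i _ →
                                                          trans (cong (c *ᶻ_) (sumBelow-*ʳ N d (F i))) (sumBelow-*ˡ N c _)) ⟩
  sumBelow² N (λ i j → c *ᶻ (F i j *ᶻ d))            ∎
  where open ≡-Reasoning

-- Summing over k collapses δ c k to the term k = c; if c ≥ N, both sides vanish as c + l > n.
sumBelow-δ-collapse : ∀ {n N} l c Z → n < N →
                      sumBelow N (λ k → δ (k + l) n *ᶻ (δ c k *ᶻ Z)) ≡ δ (c + l) n *ᶻ Z
sumBelow-δ-collapse {n} {N} l c Z n<N with c ℕ.<? N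
... | yes c<N = trans (sumBelow-single N c _ c<N off) (cong (δ (c + l) n *ᶻ_) (δ-≡-* {c} refl Z))
  where
  off : ∀ k → k < N → k ≢ c → δ (k + l) n *ᶻ (δ c k *ᶻ Z) ≡ + 0
  off k _ k≢c rewrite δ-≢-* {c} {k} (k≢c ∘ sym) Z = ℤ.*-zeroʳ (δ (k + l) n)
... | no c≮N = trans (sumBelow-zero N off) (sym (δ-≢-* c+l≢n Z))
  where
  off : ∀ k → k < N → δ (k + l) n *ᶻ (δ c k *ᶻ Z) ≡ + 0
  off k k<N rewrite δ-≢-* {c} {k} (λ c≡k → c≮N (subst (_< N) (sym c≡k) k<N)) Z = ℤ.*-zeroʳ (δ (k + l) n)
  c+l≢n : c + l ≢ n
  c+l≢n c+l≡n = c≮N (ℕ.≤-<-trans (ℕ.≤-trans (ℕ.m≤m+n c l) (ℕ.≤-reflexive c+l≡n)) n<N)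

⊛-coeff-square : ∀ f g {n N} → n < N →
                 (f ⊛ g) n ≡ sumBelow² N (λ i j → δ (i + j) n *ᶻ (f i *ᶻ g j))
⊛-coeff-square f g {n} {N} n<N = begin
  (f ⊛ g) n                                ≡⟨ sumTo≡sumBelow n _ ⟩
  sumBelow (suc n) (λ i → f i *ᶻ g (n ∸ i)) ≡⟨ sumBelow-cong (suc n) diagonal ⟩
  sumBelow (suc n) row                     ≡⟨ sumBelow-extend N row n<N (λ i n<i _ → sumBelow-zero N (λ j _ → beyond i j n<i)) ⟨
  sumBelow N row                           ∎
  where
  open ≡-Reasoning
  row : ℕ → ℤ
  row i = sumBelow N (λ j → δ (i + j) n *ᶻ (f i *ᶻ g j))
  diagonal : ∀ i → i < suc n → f i *ᶻ g (n ∸ i) ≡ row i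
  diagonal i i<1+n = sym (trans
    (sumBelow-single N (n ∸ i) _ (ℕ.≤-<-trans (ℕ.m∸n≤m n i) n<N)
      (λ j _ j≢n∸i → δ-≢-* (λ i+j≡n → j≢n∸i (ℕ.+-cancelˡ-≡ i j (n ∸ i)
                                          (trans i+j≡n (sym (ℕ.m+[n∸m]≡n (ℕ.≤-pred i<1+n)))))) _))
    (δ-≡-* (ℕ.m+[n∸m]≡n (ℕ.≤-pred i<1+n)) _))
  beyond : ∀ i j → n < i → δ (i + j) n *ᶻ (f i *ᶻ g j) ≡ + 0
  beyond i j n<i = δ-≢-* (λ i+j≡n → ℕ.<⇒≱ n<i (subst (i ≤_) i+j≡n (ℕ.m≤m+n i j))) _

⊛-comm : ∀ f g → f ⊛ g ≈ g ⊛ f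
⊛-comm f g n = begin
  (f ⊛ g) n                                                    ≡⟨ ⊛-coeff-square f g (ℕ.n<1+n n) ⟩
  sumBelow² (suc n) (λ i j → δ (i + j) n *ᶻ (f i *ᶻ g j))       ≡⟨ sumBelow-swap (suc n) (suc n) _ ⟩
  sumBelow² (suc n) (λ j i → δ (i + j) n *ᶻ (f i *ᶻ g j))       ≡⟨ sumBelow²-cong (suc n) (λ j i →
                                                                    cong₂ (λ e x → δ e n *ᶻ x) (ℕ.+-comm i j) (ℤ.*-comm (f i) (g j))) ⟩
  sumBelow² (suc n) (λ j i → δ (j + i) n *ᶻ (g j *ᶻ f i))       ≡⟨ ⊛-coeff-square g f (ℕ.n<1+n n) ⟨
  (g ⊛ f) n                                                    ∎
  where open ≡-Reasoning

⊛⊛-coeff : ∀ f g h n →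
           ((f ⊛ g) ⊛ h) n ≡ sumBelow³ (suc n) (λ i j l → δ (i + j + l) n *ᶻ (f i *ᶻ g j *ᶻ h l))
⊛⊛-coeff f g h n = begin
  ((f ⊛ g) ⊛ h) n
    ≡⟨ ⊛-coeff-square (f ⊛ g) h n<N ⟩
  sumBelow² N (λ k l → δ (k + l) n *ᶻ ((f ⊛ g) k *ᶻ h l))
    ≡⟨ sumBelow-cong N (λ k k<N → sumBelow-cong N (λ l _ → expand k l k<N)) ⟩
  sumBelow² N (λ k l → sumBelow² N (λ i j → δ (k + l) n *ᶻ (δ (i + j) k *ᶻ fgh i j l)))
    ≡⟨ sumBelow-swap N N _ ⟩
  sumBelow² N (λ l k → sumBelow² N (λ i j → δ (k + l) n *ᶻ (δ (i + j) k *ᶻ fgh i j l)))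
    ≡⟨ sumBelow-cong N (λ l _ → sumBelow³-rotate N (λ k i j → δ (k + l) n *ᶻ (δ (i + j) k *ᶻ fgh i j l))) ⟩
  sumBelow N (λ l → sumBelow³ N (λ i j k → δ (k + l) n *ᶻ (δ (i + j) k *ᶻ fgh i j l)))
    ≡⟨ sumBelow-cong N (λ l _ → sumBelow²-cong N (λ i j → sumBelow-δ-collapse l (i + j) (fgh i j l) n<N)) ⟩
  sumBelow N (λ l → sumBelow² N (λ i j → δ (i + j + l) n *ᶻ fgh i j l))
    ≡⟨ sumBelow³-rotate N (λ l i j → δ (i + j + l) n *ᶻ fgh i j l) ⟩
  sumBelow³ N (λ i j l → δ (i + j + l) n *ᶻ fgh i j l)
    ∎
  where
  open ≡-Reasoning
  N = suc n
  n<N = ℕ.n<1+n n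
  fgh : ℕ → ℕ → ℕ → ℤ
  fgh i j l = f i *ᶻ g j *ᶻ h l
  regroup : ∀ a b x y z → a *ᶻ ((b *ᶻ (x *ᶻ y)) *ᶻ z) ≡ a *ᶻ (b *ᶻ (x *ᶻ y *ᶻ z))
  regroup = solve-∀
  expand : ∀ k l → k < N → δ (k + l) n *ᶻ ((f ⊛ g) k *ᶻ h l)
                         ≡ sumBelow² N (λ i j → δ (k + l) n *ᶻ (δ (i + j) k *ᶻ fgh i j l))
  expand k l k<N = begin
    δ (k + l) n *ᶻ ((f ⊛ g) k *ᶻ h l)
      ≡⟨ cong (λ x → δ (k + l) n *ᶻ (x *ᶻ h l)) (⊛-coeff-square f g k<N) ⟩
    δ (k + l) n *ᶻ (sumBelow² N (λ i j → δ (i + j) k *ᶻ (f i *ᶻ g j)) *ᶻ h l)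
      ≡⟨ sumBelow²-*-* N (δ (k + l) n) (h l) (λ i j → δ (i + j) k *ᶻ (f i *ᶻ g j)) ⟩
    sumBelow² N (λ i j → δ (k + l) n *ᶻ ((δ (i + j) k *ᶻ (f i *ᶻ g j)) *ᶻ h l))
      ≡⟨ sumBelow²-cong N (λ i j → regroup (δ (k + l) n) (δ (i + j) k) (f i) (g j) (h l)) ⟩
    sumBelow² N (λ i j → δ (k + l) n *ᶻ (δ (i + j) k *ᶻ fgh i j l))
      ∎

⊛-assoc : ∀ f g h → (f ⊛ g) ⊛ h ≈ f ⊛ (g ⊛ h)
⊛-assoc f g h n = begin
  ((f ⊛ g) ⊛ h) n                                                  ≡⟨ ⊛⊛-coeff f g h n ⟩
  sumBelow³ N (λ i j l → δ (i + j + l) n *ᶻ (f i *ᶻ g j *ᶻ h l))    ≡⟨ sumBelow³-cong N (λ i j l →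
                                                                        cong₂ (λ e x → δ e n *ᶻ x) (rotateℕ i j l) (rotateℤ (f i) (g j) (h l))) ⟩
  sumBelow³ N (λ i j l → δ (j + l + i) n *ᶻ (g j *ᶻ h l *ᶻ f i))    ≡⟨ sumBelow³-rotate N _ ⟩
  sumBelow³ N (λ j l i → δ (j + l + i) n *ᶻ (g j *ᶻ h l *ᶻ f i))    ≡⟨ ⊛⊛-coeff g h f n ⟨
  ((g ⊛ h) ⊛ f) n                                                  ≡⟨ ⊛-comm (g ⊛ h) f n ⟩
  (f ⊛ (g ⊛ h)) n                                                  ∎
  where
  open ≡-Reasoning
  N = suc n
  rotateℕ : ∀ i j l → i + j + l ≡ j + l + i
  rotateℕ i j l = trans (ℕ.+-assoc i j l) (ℕ.+-comm i (j + l))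
  rotateℤ : ∀ x y z → x *ᶻ y *ᶻ z ≡ y *ᶻ z *ᶻ x
  rotateℤ = solve-∀

≈-isEquivalence : IsEquivalence _≈_
≈-isEquivalence = record
  { refl = λ _ → refl ; sym = λ f≈g n → sym (f≈g n) ; trans = λ f≈g g≈h n → trans (f≈g n) (g≈h n) }

open IsEquivalence ≈-isEquivalence using () renaming (refl to ≈-refl; sym to ≈-sym; trans to ≈-trans)

⊛-cong : ∀ {f f′ g g′} → f ≈ f′ → g ≈ g′ → f ⊛ g ≈ f′ ⊛ g′
⊛-cong f≈f′ g≈g′ n = sumTo-cong n (λ i _ → cong₂ _*ᶻ_ (f≈f′ i) (g≈g′ (n ∸ i)))

⊛-congˡ : ∀ f {g g′} → g ≈ g′ → f ⊛ g ≈ f ⊛ g′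
⊛-congˡ f = ⊛-cong (≈-refl {f})

⊛-congʳ : ∀ g {f f′} → f ≈ f′ → f ⊛ g ≈ f′ ⊛ g
⊛-congʳ g f≈f′ = ⊛-cong f≈f′ (≈-refl {g})

⊕-cong : ∀ {f f′ g g′} → f ≈ f′ → g ≈ g′ → f ⊕ g ≈ f′ ⊕ g′
⊕-cong f≈f′ g≈g′ n = cong₂ _+ᶻ_ (f≈f′ n) (g≈g′ n)

mono-cong : ∀ {e e′} → e ≡ e′ → mono e ≈ mono e′
mono-cong refl = ≈-refl

sumTo-+ : ∀ n f g → sumTo n (λ i → f i +ᶻ g i) ≡ sumTo n f +ᶻ sumTo n g
sumTo-+ n f g = begin
  sumTo n (λ i → f i +ᶻ g i)                 ≡⟨ sumTo≡sumBelow n _ ⟩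
  sumBelow (suc n) (λ i → f i +ᶻ g i)        ≡⟨ sumBelow-+ (suc n) f g ⟩
  sumBelow (suc n) f +ᶻ sumBelow (suc n) g   ≡⟨ cong₂ _+ᶻ_ (sumTo≡sumBelow n f) (sumTo≡sumBelow n g) ⟨
  sumTo n f +ᶻ sumTo n g                     ∎
  where open ≡-Reasoning

⊛-distribʳ-⊕ : ∀ f g h → (g ⊕ h) ⊛ f ≈ (g ⊛ f) ⊕ (h ⊛ f)
⊛-distribʳ-⊕ f g h n =
  trans (sumTo-cong n (λ i _ → ℤ.*-distribʳ-+ (f (n ∸ i)) (g i) (h i))) (sumTo-+ n _ _)

mono-⊛-≥ : ∀ e X {m} → e ≤ m → (mono e ⊛ X) m ≡ X (m ∸ e)
mono-⊛-≥ e X {m} e≤m = begin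
  (mono e ⊛ X) m                                 ≡⟨ sumTo≡sumBelow m _ ⟩
  sumBelow (suc m) (λ i → mono e i *ᶻ X (m ∸ i)) ≡⟨ sumBelow-single (suc m) e _ (s≤s e≤m) (λ i _ i≢e → δ-≢-* i≢e _) ⟩
  mono e e *ᶻ X (m ∸ e)                          ≡⟨ δ-≡-* {e} refl _ ⟩
  X (m ∸ e)                                      ∎
  where open ≡-Reasoning

mono-⊛-< : ∀ e X {m} → m < e → (mono e ⊛ X) m ≡ + 0
mono-⊛-< e X {m} m<e = trans (sumTo≡sumBelow m _) (sumBelow-zero (suc m) (λ i i<1+m →
  δ-≢-* (λ i≡e → ℕ.<⇒≱ m<e (subst (_≤ m) i≡e (ℕ.≤-pred i<1+m))) _))

⊛-identityˡ : ∀ X → one ⊛ X ≈ X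
⊛-identityˡ X m = mono-⊛-≥ 0 X z≤n

⊛-identityʳ : ∀ X → X ⊛ one ≈ X
⊛-identityʳ X = ≈-trans (⊛-comm X one) (⊛-identityˡ X)

mono-+ : ∀ e₁ e₂ → mono (e₁ + e₂) ≈ mono e₁ ⊛ mono e₂
mono-+ e₁ e₂ m with e₁ ℕ.≤? m
... | no e₁≰m = trans (δ-≢ (λ m≡e → e₁≰m (subst (e₁ ≤_) (sym m≡e) (ℕ.m≤m+n e₁ e₂))))
                      (sym (mono-⊛-< e₁ (mono e₂) (ℕ.≰⇒> e₁≰m)))
... | yes e₁≤m = trans coefficient (sym (mono-⊛-≥ e₁ (mono e₂) e₁≤m))
  where
  m≡ : m ≡ e₁ + (m ∸ e₁)
  m≡ = sym (ℕ.m+[n∸m]≡n e₁≤m)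
  coefficient : mono (e₁ + e₂) m ≡ mono e₂ (m ∸ e₁)
  coefficient with m ∸ e₁ ℕ.≟ e₂
  ... | yes m∸e₁≡e₂ = trans (δ-≡ (trans m≡ (cong (λ x → e₁ + x) m∸e₁≡e₂))) (sym (δ-≡ m∸e₁≡e₂))
  ... | no m∸e₁≢e₂ = trans (δ-≢ (λ m≡e₁+e₂ → m∸e₁≢e₂ (ℕ.+-cancelˡ-≡ e₁ _ _ (trans (sym m≡) m≡e₁+e₂))))
                           (sym (δ-≢ m∸e₁≢e₂))

⊛-commutativeMonoid : CommutativeMonoid 0ℓ 0ℓ
⊛-commutativeMonoid = record
  { Carrier = Series ; _≈_ = _≈_ ; _∙_ = _⊛_ ; ε = one
  ; isCommutativeMonoid = record
    { isMonoid = record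
      { isSemigroup = record
        { isMagma = record { isEquivalence = ≈-isEquivalence ; ∙-cong = ⊛-cong }
        ; assoc = ⊛-assoc }
      ; identity = ⊛-identityˡ , ⊛-identityʳ }
    ; comm = ⊛-comm } }

open import Algebra.Properties.CommutativeSemigroup (CommutativeMonoid.commutativeSemigroup ⊛-commutativeMonoid)
  using (interchange; xy∙z≈xz∙y)
module ≈-Reasoning = Relation.Binary.Reasoning.Setoid (CommutativeMonoid.setoid ⊛-commutativeMonoid)

-- The series P(q^s) = Σ_c P c q^(cs); in particular geomInv c s is definitionally dilate s (c ^_).
dilate : ℕ → (ℕ → ℤ) → Series
dilate s P m = sumTo m (λ c → if c * s ≡ᵇ m then P c else + 0)

dilate-cong : ∀ s {P Q} → (∀ c → P c ≡ Q c) → dilate s P ≈ dilate s Q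
dilate-cong s P≡Q m = sumTo-cong m (λ c _ → cong (if c * s ≡ᵇ m then_else + 0) (P≡Q c))

dilate-⊕ : ∀ s P Q → dilate s P ⊕ dilate s Q ≈ dilate s (λ c → P c +ᶻ Q c)
dilate-⊕ s P Q m = trans (sym (sumTo-+ m _ _)) (sumTo-cong m (λ c _ → if-+ (c * s ≡ᵇ m) (P c) (Q c)))
  where
  if-+ : ∀ b x y → (if b then x else + 0) +ᶻ (if b then y else + 0) ≡ (if b then x +ᶻ y else + 0)
  if-+ true x y = refl
  if-+ false x y = refl

dilate-multiple : ∀ {s} P q → 1 ≤ s → dilate s P (q * s) ≡ P q
dilate-multiple {s} P q 1≤s = begin
  dilate s P (q * s)                                                  ≡⟨ sumTo≡sumBelow (q * s) _ ⟩
  sumBelow (suc (q * s)) (λ c → if c * s ≡ᵇ q * s then P c else + 0)  ≡⟨ sumBelow-single _ q _ (s≤s q≤q*s) off ⟩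
  (if q * s ≡ᵇ q * s then P q else + 0)                               ≡⟨ cong (if_then P q else + 0) (≡ᵇ-true {q * s} refl) ⟩
  P q                                                                 ∎
  where
  open ≡-Reasoning
  instance _ = >-nonZero 1≤s
  q≤q*s : q ≤ q * s
  q≤q*s = ℕ.m≤m*n q s
  off : ∀ c → c < suc (q * s) → c ≢ q → (if c * s ≡ᵇ q * s then P c else + 0) ≡ + 0
  off c _ c≢q rewrite ≡ᵇ-false (c≢q ∘ ℕ.*-cancelʳ-≡ c q s) = refl

multiple≢multiple+residue : ∀ {c q s ρ} → 0 < ρ → ρ < s → c * s ≢ q * s + ρ
multiple≢multiple+residue {c} {q} {s} {ρ} 0<ρ ρ<s c*s≡ with c ℕ.≤? q
... | yes c≤q = ℕ.<-irrefl c*s≡ (ℕ.≤-<-trans (ℕ.*-monoˡ-≤ s c≤q) (ℕ.m<m+n (q * s) 0<ρ))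
... | no c≰q = ℕ.<-irrefl (sym c*s≡)
  (ℕ.<-≤-trans (ℕ.+-monoʳ-< (q * s) ρ<s) (subst (_≤ c * s) (ℕ.+-comm s (q * s)) (ℕ.*-monoˡ-≤ s (ℕ.≰⇒> c≰q))))

dilate-residue : ∀ {s} P q {ρ} → 0 < ρ → ρ < s → dilate s P (q * s + ρ) ≡ + 0
dilate-residue {s} P q {ρ} 0<ρ ρ<s = trans (sumTo≡sumBelow (q * s + ρ) _) (sumBelow-zero (suc (q * s + ρ)) (λ c _ →
  trans (if-else-0≡iverson-* (c * s ≡ᵇ q * s + ρ) (P c)) (δ-≢-* (multiple≢multiple+residue {c} {q} 0<ρ ρ<s) (P c))))

≈-byResidue : ∀ s {X Y} → 1 ≤ s → (∀ q → X (q * s) ≡ Y (q * s)) →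
              (∀ q ρ → 0 < ρ → ρ < s → X (q * s + ρ) ≡ Y (q * s + ρ)) → X ≈ Y
≈-byResidue s {X} {Y} 1≤s X≡Y-multiple X≡Y-residue m =
  subst (λ k → X k ≡ Y k) (sym m≡) (byRemainder (m % s) (DivMod.m%n<n m s))
  where
  instance _ = >-nonZero 1≤s
  m≡ : m ≡ m / s * s + m % s
  m≡ = trans (DivMod.m≡m%n+[m/n]*n m s) (ℕ.+-comm (m % s) _)
  byRemainder : ∀ ρ → ρ < s → X (m / s * s + ρ) ≡ Y (m / s * s + ρ)
  byRemainder zero _ rewrite ℕ.+-identityʳ (m / s * s) = X≡Y-multiple (m / s)
  byRemainder (suc ρ) ρ<s = X≡Y-residue (m / s) (suc ρ) (s≤s z≤n) ρ<s

mono-⊛-dilate : ∀ r s P → 1 ≤ s →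
                mono (r * s) ⊛ dilate s P ≈ dilate s (λ c → if r ≤ᵇ c then P (c ∸ r) else + 0)
mono-⊛-dilate r s P 1≤s = ≈-byResidue s 1≤s multiple residue
  where
  instance _ = >-nonZero 1≤s
  shifted : ℕ → ℤ
  shifted c = if r ≤ᵇ c then P (c ∸ r) else + 0
  multiple : ∀ q → (mono (r * s) ⊛ dilate s P) (q * s) ≡ dilate s shifted (q * s)
  multiple q with r ℕ.≤? q
  ... | yes r≤q rewrite dilate-multiple shifted q 1≤s | ≤ᵇ-true r≤q = begin
    (mono (r * s) ⊛ dilate s P) (q * s) ≡⟨ mono-⊛-≥ (r * s) (dilate s P) (ℕ.*-monoˡ-≤ s r≤q) ⟩
    dilate s P (q * s ∸ r * s)          ≡⟨ cong (dilate s P) (ℕ.*-distribʳ-∸ s q r) ⟨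
    dilate s P ((q ∸ r) * s)            ≡⟨ dilate-multiple P (q ∸ r) 1≤s ⟩
    P (q ∸ r)                           ∎
    where open ≡-Reasoning
  ... | no r≰q rewrite dilate-multiple shifted q 1≤s | ≤ᵇ-false r≰q =
    mono-⊛-< (r * s) (dilate s P) (ℕ.*-monoˡ-< s (ℕ.≰⇒> r≰q))
  residue : ∀ q ρ → 0 < ρ → ρ < s → (mono (r * s) ⊛ dilate s P) (q * s + ρ) ≡ dilate s shifted (q * s + ρ)
  residue q ρ 0<ρ ρ<s with r ℕ.≤? q
  ... | yes r≤q rewrite dilate-residue shifted q 0<ρ ρ<s = begin
    (mono (r * s) ⊛ dilate s P) (q * s + ρ) ≡⟨ mono-⊛-≥ (r * s) (dilate s P) (ℕ.≤-trans r*s≤q*s (ℕ.m≤m+n (q * s) ρ)) ⟩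
    dilate s P (q * s + ρ ∸ r * s)          ≡⟨ cong (dilate s P) (ℕ.+-∸-comm ρ r*s≤q*s) ⟩
    dilate s P (q * s ∸ r * s + ρ)          ≡⟨ cong (λ k → dilate s P (k + ρ)) (ℕ.*-distribʳ-∸ s q r) ⟨
    dilate s P ((q ∸ r) * s + ρ)            ≡⟨ dilate-residue P (q ∸ r) 0<ρ ρ<s ⟩
    + 0                                     ∎
    where
    open ≡-Reasoning
    r*s≤q*s = ℕ.*-monoˡ-≤ s r≤q
  ... | no r≰q rewrite dilate-residue shifted q 0<ρ ρ<s = mono-⊛-< (r * s) (dilate s P) (begin-strict
    q * s + ρ   <⟨ ℕ.+-monoʳ-< (q * s) ρ<s ⟩
    q * s + s   ≡⟨ ℕ.+-comm (q * s) s ⟩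
    suc q * s   ≤⟨ ℕ.*-monoˡ-≤ s (ℕ.≰⇒> r≰q) ⟩
    r * s       ∎)
    where open ℕ.≤-Reasoning

one⊕mono-⊛-dilate : ∀ s P → 1 ≤ s →
  (one ⊕ mono s) ⊛ dilate s P ≈ dilate s (λ c → P c +ᶻ (if 1 ≤ᵇ c then P (c ∸ 1) else + 0))
one⊕mono-⊛-dilate s P 1≤s = begin
  (one ⊕ mono s) ⊛ dilate s P                       ≈⟨ ⊛-distribʳ-⊕ (dilate s P) one (mono s) ⟩
  (one ⊛ dilate s P) ⊕ (mono s ⊛ dilate s P)        ≈⟨ ⊕-cong (⊛-identityˡ (dilate s P)) mono-s ⟩
  dilate s P ⊕ dilate s (λ c → if 1 ≤ᵇ c then P (c ∸ 1) else + 0) ≈⟨ dilate-⊕ s P _ ⟩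
  dilate s (λ c → P c +ᶻ (if 1 ≤ᵇ c then P (c ∸ 1) else + 0)) ∎
  where
  open ≈-Reasoning
  mono-s = ≈-trans (⊛-congʳ (dilate s P) (mono-cong (sym (ℕ.*-identityˡ s)))) (mono-⊛-dilate 1 s P 1≤s)

dilate-δ0 : ∀ s → 1 ≤ s → dilate s (λ c → δ c 0) ≈ one
dilate-δ0 s 1≤s = ≈-byResidue s 1≤s multiple residue
  where
  multiple : ∀ q → dilate s (λ c → δ c 0) (q * s) ≡ one (q * s)
  multiple zero = dilate-multiple (λ c → δ c 0) 0 1≤s
  multiple (suc q) = trans (dilate-multiple (λ c → δ c 0) (suc q) 1≤s)
                           (sym (δ-≢ (ℕ.>⇒≢ (ℕ.<-≤-trans 1≤s (ℕ.m≤m+n s (q * s))))))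
  residue : ∀ q ρ → 0 < ρ → ρ < s → dilate s (λ c → δ c 0) (q * s + ρ) ≡ one (q * s + ρ)
  residue q ρ 0<ρ ρ<s = trans (dilate-residue (λ c → δ c 0) q 0<ρ ρ<s)
                              (sym (δ-≢ (ℕ.>⇒≢ (ℕ.<-≤-trans 0<ρ (ℕ.m≤n+m ρ (q * s))))))

-- The number of ways a part size can occur c times: only its first copy may be overlined.
overlineChoices : ℕ → ℤ
overlineChoices zero = + 1
overlineChoices (suc _) = + 2

atLeast : ℕ → ℕ → ℤ
atLeast r c = iverson (r ≤ᵇ c)

overFactor : ℕ → Series
overFactor s = (one ⊕ mono s) ⊛ geomInv 1ℤ s

dilate-overlineChoices : ∀ s → 1 ≤ s → dilate s overlineChoices ≈ overFactor s
dilate-overlineChoices s 1≤s = ≈-sym (≈-trans (one⊕mono-⊛-dilate s (1ℤ ^ᶻ_) 1≤s) (dilate-cong s choices))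
  where
  choices : ∀ c → 1ℤ ^ᶻ c +ᶻ (if 1 ≤ᵇ c then 1ℤ ^ᶻ (c ∸ 1) else + 0) ≡ overlineChoices c
  choices zero = refl
  choices (suc c) rewrite ℤ.^-zeroˡ c = refl

dilate-atLeast : ∀ r s → 1 ≤ s → dilate s (atLeast r) ≈ mono (r * s) ⊛ geomInv 1ℤ s
dilate-atLeast r s 1≤s = ≈-sym (≈-trans (mono-⊛-dilate r s (1ℤ ^ᶻ_) 1≤s) (dilate-cong s indicator))
  where
  indicator : ∀ c → (if r ≤ᵇ c then 1ℤ ^ᶻ (c ∸ r) else + 0) ≡ atLeast r c
  indicator c with r ≤ᵇ c
  ... | true = ℤ.^-zeroˡ (c ∸ r)
  ... | false = refl

one⊕mono-inverseʳ : ∀ s → 1 ≤ s → (one ⊕ mono s) ⊛ geomInv -1ℤ s ≈ one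
one⊕mono-inverseʳ s 1≤s =
  ≈-trans (one⊕mono-⊛-dilate s (-1ℤ ^ᶻ_) 1≤s) (≈-trans (dilate-cong s telescope) (dilate-δ0 s 1≤s))
  where
  telescope : ∀ c → -1ℤ ^ᶻ c +ᶻ (if 1 ≤ᵇ c then -1ℤ ^ᶻ (c ∸ 1) else + 0) ≡ δ c 0
  telescope zero = refl
  telescope (suc c) = trans (cong (_+ᶻ -1ℤ ^ᶻ c) (ℤ.-1*i≡-i (-1ℤ ^ᶻ c))) (ℤ.+-inverseˡ (-1ℤ ^ᶻ c))

dilate-atLeast≈overFactor-⊛ : ∀ r s → 1 ≤ s →
  dilate s (atLeast r) ≈ overFactor s ⊛ (mono (r * s) ⊛ geomInv -1ℤ s)
dilate-atLeast≈overFactor-⊛ r s 1≤s = begin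
  dilate s (atLeast r)    ≈⟨ dilate-atLeast r s 1≤s ⟩
  M ⊛ G                   ≈⟨ ⊛-identityʳ (M ⊛ G) ⟨
  (M ⊛ G) ⊛ one           ≈⟨ ⊛-cong (⊛-comm G M) (one⊕mono-inverseʳ s 1≤s) ⟨
  (G ⊛ M) ⊛ (U ⊛ H)       ≈⟨ interchange G M U H ⟩
  (G ⊛ U) ⊛ (M ⊛ H)       ≈⟨ ⊛-congʳ (M ⊛ H) (⊛-comm G U) ⟩
  (U ⊛ G) ⊛ (M ⊛ H)       ∎
  where
  open ≈-Reasoning
  M = mono (r * s)
  G = geomInv 1ℤ s
  H = geomInv -1ℤ s
  U = one ⊕ mono s

prodFrom1To-cong : ∀ N {F F′} → (∀ s → 1 ≤ s → s ≤ N → F s ≈ F′ s) → prodFrom1To N F ≈ prodFrom1To N F′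
prodFrom1To-cong zero F≈F′ = ≈-refl
prodFrom1To-cong (suc N) F≈F′ =
  ⊛-cong (prodFrom1To-cong N (λ s 1≤s s≤N → F≈F′ s 1≤s (ℕ.m≤n⇒m≤1+n s≤N))) (F≈F′ (suc N) (s≤s z≤n) ℕ.≤-refl)

prodFrom1To-extract : ∀ N {F F′} t R → 1 ≤ t → t ≤ N →
  (∀ s → 1 ≤ s → s ≤ N → s ≢ t → F s ≈ F′ s) → F t ≈ F′ t ⊛ R →
  prodFrom1To N F ≈ prodFrom1To N F′ ⊛ R
prodFrom1To-extract zero t R 1≤t t≤0 _ _ = contradiction (ℕ.≤-trans 1≤t t≤0) λ ()
prodFrom1To-extract (suc N) {F} {F′} t R 1≤t t≤1+N F≈F′ Ft≈ with t ℕ.≟ suc N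
... | yes refl = begin
  prodFrom1To N F ⊛ F t           ≈⟨ ⊛-cong (prodFrom1To-cong N (λ s 1≤s s≤N →
                                               F≈F′ s 1≤s (ℕ.m≤n⇒m≤1+n s≤N) (ℕ.<⇒≢ (s≤s s≤N)))) Ft≈ ⟩
  prodFrom1To N F′ ⊛ (F′ t ⊛ R)   ≈⟨ ⊛-assoc (prodFrom1To N F′) (F′ t) R ⟨
  (prodFrom1To N F′ ⊛ F′ t) ⊛ R   ∎
  where open ≈-Reasoning
... | no t≢1+N = begin
  prodFrom1To N F ⊛ F (suc N)            ≈⟨ ⊛-cong (prodFrom1To-extract N t R 1≤t t≤N
                                                      (λ s 1≤s s≤N → F≈F′ s 1≤s (ℕ.m≤n⇒m≤1+n s≤N)) Ft≈)
                                                   (F≈F′ (suc N) (s≤s z≤n) ℕ.≤-refl (t≢1+N ∘ sym)) ⟩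
  (prodFrom1To N F′ ⊛ R) ⊛ F′ (suc N)    ≈⟨ xy∙z≈xz∙y (prodFrom1To N F′) R (F′ (suc N)) ⟩
  (prodFrom1To N F′ ⊛ F′ (suc N)) ⊛ R    ∎
  where
  open ≈-Reasoning
  t≤N = ℕ.≤-pred (ℕ.≤∧≢⇒< t≤1+N t≢1+N)

⊛-coeff-of-one : ∀ P Y m → (∀ k → k ≤ m → Y k ≡ one k) → (P ⊛ Y) m ≡ P m
⊛-coeff-of-one P Y m Y≡one =
  trans (sumTo-cong m (λ i i≤m → cong (P i *ᶻ_) (Y≡one (m ∸ i) (ℕ.m∸n≤m m i)))) (⊛-identityʳ P m)

-- Factor s is 1 up to degree s − 1, so the factors beyond m do not affect the coefficient of q^m.
prodFrom1To-truncate : ∀ F → (∀ s k → k < s → F s k ≡ one k) →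
                       ∀ N m → m ≤ N → prodFrom1To N F m ≡ prodFrom1To m F m
prodFrom1To-truncate F F≡one zero .zero z≤n = refl
prodFrom1To-truncate F F≡one (suc N) m m≤1+N with m ℕ.≟ suc N
... | yes refl = refl
... | no m≢1+N = trans (⊛-coeff-of-one (prodFrom1To N F) (F (suc N)) m (λ k k≤m → F≡one (suc N) k (s≤s (ℕ.≤-trans k≤m m≤N))))
                       (prodFrom1To-truncate F F≡one N m m≤N)
  where m≤N = ℕ.≤-pred (ℕ.≤∧≢⇒< m≤1+N m≢1+N)

overFactor-low : ∀ s k → k < s → overFactor s k ≡ one k
overFactor-low s zero 0<s = trans (sym (dilate-overlineChoices s 0<s 0)) (dilate-multiple overlineChoices 0 0<s)
overFactor-low s (suc k) k<s = trans (sym (dilate-overlineChoices s 1≤s (suc k))) (dilate-residue overlineChoices 0 (s≤s z≤n) k<s)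
  where 1≤s = ℕ.<-trans (s≤s z≤n) k<s

overGF-⊛-coeff : ∀ n Y → (prodFrom1To n overFactor ⊛ Y) n ≡ (overGF ⊛ Y) n
overGF-⊛-coeff n Y = sumTo-cong n (λ i i≤n → cong (_*ᶻ Y (n ∸ i)) (prodFrom1To-truncate overFactor overFactor-low n i i≤n))

-- The condition imposed on the parts of one size, for a threshold r:
-- free: none; plain: at least r parts, none overlined; overlined: at least r parts, the first overlined.
data Restriction : Set where
  free plain overlined : Restriction

Profile : Set
Profile = ℕ → Restriction

-- The admissible overline flags of the first of c parts of one size.
flags : ℕ → Restriction → ℕ → List Bool
flags r free zero = false ∷ []
flags r free (suc _) = false ∷ true ∷ []
flags r plain c = if r ≤ᵇ c then false ∷ [] else []
flags r overlined c = if r ≤ᵇ c then true ∷ [] else []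

flagCount : ℕ → Restriction → ℕ → ℤ
flagCount r κ c = + length (flags r κ c)

block : ℕ → ℕ → Bool → List Part
block s zero b = []
block s (suc c) b = (s , b) ∷ replicate c (s , false)

blocksOfSize : ℕ → Restriction → ℕ → ℕ → ℕ → List (List Part)
blocksOfSize r κ s m c = if c * s ≡ᵇ m then map (block s c) (flags r κ c) else []

blocksOfWeight : ℕ → Restriction → ℕ → ℕ → List (List Part)
blocksOfWeight r κ s m = concatMap (blocksOfSize r κ s m) (upTo (suc m))

withBlocks : ℕ → Restriction → ℕ → ℕ → List Part → List (List Part)
withBlocks r κ s m π = map (_++ π) (blocksOfWeight r κ s m)

admissible : ℕ → Profile → ℕ → ℕ → List (List Part)
extensions : ℕ → Profile → ℕ → ℕ → ℕ → List (List Part)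

-- The overpartitions of n with parts ≤ N whose parts of each size s obey σ s.
admissible r σ zero n = if n ≡ᵇ 0 then [] ∷ [] else []
admissible r σ (suc N) n = concatMap (extensions r σ N n) (upTo (suc n))

-- The admissible overpartitions of i with parts ≤ N, completed to weight n by a block of parts N + 1.
extensions r σ N n i = concatMap (withBlocks r (σ (suc N)) (suc N) (n ∸ i)) (admissible r σ N i)

admissibleGF : ℕ → Profile → ℕ → Series
admissibleGF r σ N = prodFrom1To N (λ s → dilate s (flagCount r (σ s)))

length-concatMap-upTo : ∀ {A : Set} (f : ℕ → List A) n →
                        + length (concatMap f (upTo n)) ≡ sumBelow n (λ i → + length (f i))
length-concatMap-upTo f zero = refl
length-concatMap-upTo f (suc n) = begin
  + length (concatMap f (upTo (suc n)))                    ≡⟨ cong (λ xs → + length (concatMap f xs)) (List.upTo-∷ʳ n) ⟨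
  + length (concatMap f (upTo n ∷ʳ n))                     ≡⟨ cong (λ xs → + length xs) (List.concatMap-++ f (upTo n) (n ∷ [])) ⟩
  + length (concatMap f (upTo n) ++ f n ++ [])             ≡⟨ cong +_ (List.length-++ (concatMap f (upTo n))) ⟩
  + (length (concatMap f (upTo n)) + length (f n ++ []))   ≡⟨ ℤ.pos-+ (length (concatMap f (upTo n))) _ ⟩
  + length (concatMap f (upTo n)) +ᶻ + length (f n ++ [])  ≡⟨ cong₂ _+ᶻ_ (length-concatMap-upTo f n)
                                                                       (cong (λ xs → + length xs) (List.++-identityʳ (f n))) ⟩
  sumBelow n (λ i → + length (f i)) +ᶻ + length (f n)      ∎
  where open ≡-Reasoning

length-concatMap-map : ∀ {A B C : Set} (g : A → B → C) xs ys →
                       length (concatMap (λ x → map (g x) ys) xs) ≡ length xs * length ys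
length-concatMap-map g [] ys = refl
length-concatMap-map g (x ∷ xs) ys =
  trans (List.length-++ (map (g x) ys)) (cong₂ _+_ (List.length-map (g x) ys) (length-concatMap-map g xs ys))

length-if-map : ∀ {A B : Set} b (f : A → B) xs →
                + length (if b then map f xs else []) ≡ (if b then + length xs else + 0)
length-if-map true f xs = cong +_ (List.length-map f xs)
length-if-map false f xs = refl

length-blocksOfWeight : ∀ r κ s m → + length (blocksOfWeight r κ s m) ≡ dilate s (flagCount r κ) m
length-blocksOfWeight r κ s m = trans (length-concatMap-upTo (blocksOfSize r κ s m) (suc m)) (trans
  (sumBelow-cong (suc m) (λ c _ → length-if-map (c * s ≡ᵇ m) (block s c) (flags r κ c)))
  (sym (sumTo≡sumBelow m _)))

length-admissible : ∀ r σ N n → + length (admissible r σ N n) ≡ admissibleGF r σ N n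
length-admissible r σ zero zero = refl
length-admissible r σ zero (suc n) = refl
length-admissible r σ (suc N) n = trans (length-concatMap-upTo (extensions r σ N n) (suc n)) (trans
  (sumBelow-cong (suc n) (λ i _ → begin
    + length (extensions r σ N n i)
      ≡⟨ cong +_ (length-concatMap-map (λ π β → β ++ π) (admissible r σ N i) (Bs (n ∸ i))) ⟩
    + (length (admissible r σ N i) * length (Bs (n ∸ i)))
      ≡⟨ ℤ.pos-* (length (admissible r σ N i)) _ ⟩
    + length (admissible r σ N i) *ᶻ + length (Bs (n ∸ i))
      ≡⟨ cong₂ _*ᶻ_ (length-admissible r σ N i) (length-blocksOfWeight r (σ (suc N)) (suc N) (n ∸ i)) ⟩
    admissibleGF r σ N i *ᶻ dilate (suc N) (flagCount r (σ (suc N))) (n ∸ i) ∎))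
  (sym (sumTo≡sumBelow n _)))
  where
  open ≡-Reasoning
  Bs = blocksOfWeight r (σ (suc N)) (suc N)

hasOverlined : ℕ → List Part → Bool
hasOverlined t [] = false
hasOverlined t ((s , b) ∷ π) = if s ≡ᵇ t then b ∨ hasOverlined t π else hasOverlined t π

PartsAtMost : ℕ → List Part → Set
PartsAtMost N = All (λ p → proj₁ p ≤ N)

OfSize : ℕ → List Part → Set
OfSize s = All (λ p → proj₁ p ≡ s)

dropSize : ℕ → List Part → List Part
dropSize s [] = []
dropSize s ((t , b) ∷ π) = if t ≡ᵇ s then dropSize s π else (t , b) ∷ π

block-ofSize : ∀ s c b → OfSize s (block s c b)
block-ofSize s zero b = []
block-ofSize s (suc c) b = refl ∷ All.replicate⁺ c refl

length-block : ∀ s c b → length (block s c b) ≡ c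
length-block s zero b = refl
length-block s (suc c) b = cong suc (List.length-replicate c)

countSize-ofSize-≢ : ∀ {s t β} π → OfSize s β → s ≢ t → countSize t (β ++ π) ≡ countSize t π
countSize-ofSize-≢ π [] s≢t = refl
countSize-ofSize-≢ π (refl ∷ sizes) s≢t rewrite ≡ᵇ-false s≢t = countSize-ofSize-≢ π sizes s≢t

countSize-ofSize : ∀ {s β} π → OfSize s β → countSize s (β ++ π) ≡ length β + countSize s π
countSize-ofSize π [] = refl
countSize-ofSize {s} π (refl ∷ sizes) rewrite ≡ᵇ-true {s} refl = cong suc (countSize-ofSize π sizes)

hasOverlined-ofSize-≢ : ∀ {s t β} π → OfSize s β → s ≢ t → hasOverlined t (β ++ π) ≡ hasOverlined t π
hasOverlined-ofSize-≢ π [] s≢t = refl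
hasOverlined-ofSize-≢ π (refl ∷ sizes) s≢t rewrite ≡ᵇ-false s≢t = hasOverlined-ofSize-≢ π sizes s≢t

weight-ofSize : ∀ {s β} π → OfSize s β → weight (β ++ π) ≡ length β * s + weight π
weight-ofSize π [] = refl
weight-ofSize {s} π (refl ∷ sizes) = trans (cong (λ x → s + x) (weight-ofSize π sizes)) (sym (ℕ.+-assoc s _ (weight π)))

positive-ofSize : ∀ {s β π} → OfSize s β → 1 ≤ s → Positive π → Positive (β ++ π)
positive-ofSize [] _ pos = pos
positive-ofSize (refl ∷ sizes) 1≤s pos = 1≤s , positive-ofSize sizes 1≤s pos

dropSize-ofSize : ∀ {N β π} → OfSize (suc N) β → PartsAtMost N π → dropSize (suc N) (β ++ π) ≡ π
dropSize-ofSize {N} (refl ∷ sizes) π≤N rewrite ≡ᵇ-true {suc N} refl = dropSize-ofSize sizes π≤N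
dropSize-ofSize [] [] = refl
dropSize-ofSize {N} [] ((t≤N ∷ _)) rewrite ≡ᵇ-false (ℕ.<⇒≢ (s≤s t≤N)) = refl

countSize-beyond : ∀ {N t π} → PartsAtMost N π → N < t → countSize t π ≡ 0
countSize-beyond [] _ = refl
countSize-beyond (s≤N ∷ π≤N) N<t rewrite ≡ᵇ-false (ℕ.<⇒≢ (ℕ.≤-<-trans s≤N N<t)) = countSize-beyond π≤N N<t

hasOverlined-beyond : ∀ {N t π} → PartsAtMost N π → N < t → hasOverlined t π ≡ false
hasOverlined-beyond [] _ = refl
hasOverlined-beyond (s≤N ∷ π≤N) N<t rewrite ≡ᵇ-false (ℕ.<⇒≢ (ℕ.≤-<-trans s≤N N<t)) = hasOverlined-beyond π≤N N<t

hasOverlined-block : ∀ s c b π → hasOverlined s π ≡ false → hasOverlined s (block s (suc c) b ++ π) ≡ b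
hasOverlined-block s c b π ¬π rewrite ≡ᵇ-true {s} refl = trans (cong (b ∨_) (noneOverlined c)) (Bool.∨-identityʳ b)
  where
  noneOverlined : ∀ c → hasOverlined s (replicate c (s , false) ++ π) ≡ false
  noneOverlined zero = ¬π
  noneOverlined (suc c) rewrite ≡ᵇ-true {s} refl = noneOverlined c

-- A block of no parts carries no flag; otherwise its flag is read off as hasOverlined.
block-flag : ∀ s c b π → hasOverlined s π ≡ false → block s c b ≡ block s c (hasOverlined s (block s c b ++ π))
block-flag s zero b π _ = refl
block-flag s (suc c) b π ¬π = cong (block s (suc c)) (sym (hasOverlined-block s c b π ¬π))

ordered-∷-larger : ∀ N b π → PartsAtMost N π → Ordered π → Ordered ((suc N , b) ∷ π)
ordered-∷-larger N b [] _ _ = tt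
ordered-∷-larger N b ((t , b′) ∷ π) (t≤N ∷ _) ord =
  ℕ.m≤n⇒m≤1+n t≤N , (λ t≡1+N → contradiction t≡1+N (ℕ.<⇒≢ (s≤s t≤N))) , ord

ordered-block : ∀ N c b π → PartsAtMost N π → Ordered π → Ordered (block (suc N) c b ++ π)
ordered-block N zero b π _ ord = ord
ordered-block N (suc c) b π π≤N ord = ordered-copies c b
  where
  ordered-copies : ∀ c b → Ordered ((suc N , b) ∷ replicate c (suc N , false) ++ π)
  ordered-copies zero b = ordered-∷-larger N b π π≤N ord
  ordered-copies (suc c) b = ℕ.≤-refl , (λ _ → refl) , ordered-copies c false

ordered-tail : ∀ p π → Ordered (p ∷ π) → Ordered π
ordered-tail p [] _ = tt
ordered-tail p (_ ∷ π) (_ , _ , ord) = ord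

ordered-partsAtMost : ∀ s b π → Ordered ((s , b) ∷ π) → PartsAtMost s π
ordered-partsAtMost s b [] _ = []
ordered-partsAtMost s b ((t , b′) ∷ π) (t≤s , _ , ord) =
  t≤s ∷ All.map (λ u≤t → ℕ.≤-trans u≤t t≤s) (ordered-partsAtMost t b′ π ord)

decompose : ∀ N π → IsOverpartition π → PartsAtMost (suc N) π →
  ∃ λ c → ∃ λ b → ∃ λ π′ → π ≡ block (suc N) c b ++ π′ × IsOverpartition π′ × PartsAtMost N π′
decompose N [] ov _ = 0 , false , [] , refl , ov , []
decompose N ((s , b) ∷ ρ) ((1≤s , pos) , ord) (s≤1+N ∷ ρ≤1+N) with s ℕ.≟ suc N
... | no s≢1+N =
  0 , false , (s , b) ∷ ρ , refl , ((1≤s , pos) , ord) , s≤N ∷ All.map (λ t≤s → ℕ.≤-trans t≤s s≤N) (ordered-partsAtMost s b ρ ord)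
  where s≤N = ℕ.≤-pred (ℕ.≤∧≢⇒< s≤1+N s≢1+N)
... | yes refl with decompose N ρ (pos , ordered-tail (s , b) ρ ord) ρ≤1+N
...   | zero , _ , ρ′ , refl , ov′ , ρ′≤N = 1 , b , ρ′ , refl , ov′ , ρ′≤N
...   | suc c , b′ , ρ′ , refl , ov′ , ρ′≤N with ord
...     | _ , b′-plain , _ rewrite b′-plain refl = suc (suc c) , b , ρ′ , refl , ov′ , ρ′≤N

∈-concatMap⁻′ : ∀ {A B : Set} (f : A → List B) {xs y} → y ∈ concatMap f xs → ∃ λ x → x ∈ xs × y ∈ f x
∈-concatMap⁻′ f = find ∘ ∈-concatMap⁻ f

∈-concatMap⁺′ : ∀ {A B : Set} (f : A → List B) {xs x y} → x ∈ xs → y ∈ f x → y ∈ concatMap f xs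
∈-concatMap⁺′ f x∈xs y∈fx = ∈-concatMap⁺ f (lose x∈xs y∈fx)

∈-if⁻ : ∀ {A : Set} b {xs : List A} {y} → y ∈ (if b then xs else []) → b ≡ true × y ∈ xs
∈-if⁻ true y∈xs = refl , y∈xs

∈-if⁺ : ∀ {A : Set} {b} {xs : List A} {y} → b ≡ true → y ∈ xs → y ∈ (if b then xs else [])
∈-if⁺ refl y∈xs = y∈xs

unique-if : ∀ {A : Set} b {xs : List A} → Unique xs → Unique (if b then xs else [])
unique-if true u = u
unique-if false u = []

unique-concatMap : ∀ {A B : Set} (f : A → List B) {xs} → Unique xs → (∀ {x} → x ∈ xs → Unique (f x)) →
  (∀ {x x′ y} → x ∈ xs → x′ ∈ xs → y ∈ f x → y ∈ f x′ → x ≡ x′) → Unique (concatMap f xs)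
unique-concatMap f {[]} _ _ _ = []
unique-concatMap f {x ∷ xs} (x∉xs ∷ u) u-f separate =
  Unique.++⁺ (u-f (here refl)) (unique-concatMap f u (u-f ∘ there) (λ p p′ → separate (there p) (there p′))) disjoint
  where
  disjoint : ∀ {y} → ¬ (y ∈ f x × y ∈ concatMap f xs)
  disjoint (y∈fx , y∈rest) with ∈-concatMap⁻′ f y∈rest
  ... | x′ , x′∈xs , y∈fx′ = All.lookup x∉xs x′∈xs (separate (here refl) (there x′∈xs) y∈fx y∈fx′)

flags-zero : ∀ {r} κ {b} → 1 ≤ r → b ∈ flags r κ 0 → b ≡ false
flags-zero free _ (here refl) = refl
flags-zero {suc r} plain _ ()
flags-zero {suc r} overlined _ ()

unique-blocks : ∀ r κ s c → Unique (map (block s c) (flags r κ c))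
unique-blocks r free s zero = [] ∷ []
unique-blocks r free s (suc c) = ((λ ()) ∷ []) ∷ [] ∷ []
unique-blocks r plain s c with r ≤ᵇ c
... | true = [] ∷ []
... | false = []
unique-blocks r overlined s c with r ≤ᵇ c
... | true = [] ∷ []
... | false = []

∈-blocksOfWeight⁻ : ∀ {r κ s m β} → β ∈ blocksOfWeight r κ s m →
  ∃ λ c → ∃ λ b → c * s ≡ m × b ∈ flags r κ c × β ≡ block s c b
∈-blocksOfWeight⁻ {r} {κ} {s} {m} β∈ with ∈-concatMap⁻′ (blocksOfSize r κ s m) {upTo (suc m)} β∈
... | c , _ , β∈c with ∈-if⁻ (c * s ≡ᵇ m) β∈c
...   | c*s≡ᵇm , β∈map with ∈-map⁻ (block s c) β∈map
...     | b , b∈ , refl = c , b , ≡ᵇ-true⁻ c*s≡ᵇm , b∈ , refl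

∈-blocksOfWeight⁺ : ∀ {r κ s m c b} → 1 ≤ s → c * s ≡ m → b ∈ flags r κ c → block s c b ∈ blocksOfWeight r κ s m
∈-blocksOfWeight⁺ {r} {κ} {s} {m} {c} 1≤s refl b∈ =
  ∈-concatMap⁺′ (blocksOfSize r κ s m) (∈-upTo⁺ (s≤s (ℕ.m≤m*n c s))) (∈-if⁺ (≡ᵇ-true {c * s} refl) (∈-map⁺ (block s c) b∈))
  where instance _ = >-nonZero 1≤s

Respects : ℕ → Profile → ℕ → List Part → Set
Respects r σ N π = ∀ t → 1 ≤ t → t ≤ N → hasOverlined t π ∈ flags r (σ t) (countSize t π)

IsAdmissible : ℕ → Profile → ℕ → ℕ → List Part → Set
IsAdmissible r σ N n π = IsOverpartition π × PartsAtMost N π × Respects r σ N π × weight π ≡ n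

∈-admissible-suc⁻ : ∀ {r σ N n π} → π ∈ admissible r σ (suc N) n →
  ∃ λ i → ∃ λ β → ∃ λ π′ →
    i ≤ n × β ∈ blocksOfWeight r (σ (suc N)) (suc N) (n ∸ i) × π′ ∈ admissible r σ N i × π ≡ β ++ π′
∈-admissible-suc⁻ {r} {σ} {N} {n} π∈ with ∈-concatMap⁻′ (extensions r σ N n) {upTo (suc n)} π∈
... | i , i∈ , π∈i with ∈-concatMap⁻′ (withBlocks r (σ (suc N)) (suc N) (n ∸ i)) π∈i
...   | π′ , π′∈ , π∈β with ∈-map⁻ (_++ π′) π∈β
...     | β , β∈ , refl = i , β , π′ , ℕ.≤-pred (∈-upTo⁻ i∈) , β∈ , π′∈ , refl

∈-admissible-suc⁺ : ∀ {r σ N n i β π′} → i ≤ n → β ∈ blocksOfWeight r (σ (suc N)) (suc N) (n ∸ i) →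
  π′ ∈ admissible r σ N i → β ++ π′ ∈ admissible r σ (suc N) n
∈-admissible-suc⁺ {r} {σ} {N} {n} {i} {β} {π′} i≤n β∈ π′∈ =
  ∈-concatMap⁺′ (extensions r σ N n) (∈-upTo⁺ (s≤s i≤n))
    (∈-concatMap⁺′ (withBlocks r (σ (suc N)) (suc N) (n ∸ i)) π′∈ (∈-map⁺ (_++ π′) β∈))

respects-block : ∀ {r σ N c b π} → 1 ≤ r → b ∈ flags r (σ (suc N)) c → PartsAtMost N π → Respects r σ N π →
                 Respects r σ (suc N) (block (suc N) c b ++ π)
respects-block {r} {σ} {N} {c} {b} {π} 1≤r b∈ π≤N resp t 1≤t t≤1+N with suc N ℕ.≟ t
... | no 1+N≢t rewrite hasOverlined-ofSize-≢ π (block-ofSize (suc N) c b) 1+N≢t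
                     | countSize-ofSize-≢ π (block-ofSize (suc N) c b) 1+N≢t =
  resp t 1≤t (ℕ.≤-pred (ℕ.≤∧≢⇒< t≤1+N (1+N≢t ∘ sym)))
... | yes refl rewrite countSize-ofSize π (block-ofSize (suc N) c b) | countSize-beyond π≤N (ℕ.n<1+n N)
                     | ℕ.+-identityʳ (length (block (suc N) c b)) | length-block (suc N) c b = flag c b∈
  where
  flag : ∀ c → b ∈ flags r (σ (suc N)) c → hasOverlined (suc N) (block (suc N) c b ++ π) ∈ flags r (σ (suc N)) c
  flag zero b∈ rewrite hasOverlined-beyond π≤N (ℕ.n<1+n N) = subst (_∈ flags r (σ (suc N)) 0) (flags-zero (σ (suc N)) 1≤r b∈) b∈
  flag (suc c) b∈ rewrite hasOverlined-block (suc N) c b π (hasOverlined-beyond π≤N (ℕ.n<1+n N)) = b∈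

admissible-sound : ∀ r σ N n π → 1 ≤ r → π ∈ admissible r σ N n → IsAdmissible r σ N n π
admissible-sound r σ zero zero .[] _ (here refl) = (tt , tt) , [] , (λ t 1≤t t≤0 → contradiction (ℕ.≤-trans 1≤t t≤0) λ ()) , refl
admissible-sound r σ (suc N) n π 1≤r π∈ with ∈-admissible-suc⁻ {r} {σ} {N} {n} π∈
... | i , β , π′ , i≤n , β∈ , π′∈ , refl
  with ∈-blocksOfWeight⁻ {r} {σ (suc N)} {suc N} {n ∸ i} β∈ | admissible-sound r σ N i π′ 1≤r π′∈
...   | c , b , c*s≡ , b∈ , refl | (pos , ord) , π′≤N , resp , refl =
  (positive-ofSize (block-ofSize (suc N) c b) (s≤s z≤n) pos , ordered-block N c b π′ π′≤N ord) ,
  All.++⁺ (All.map (λ { refl → ℕ.≤-refl }) (block-ofSize (suc N) c b)) (All.map ℕ.m≤n⇒m≤1+n π′≤N) ,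
  respects-block {r} {σ} {N} {c} {b} {π′} 1≤r b∈ π′≤N resp ,
  (begin
    weight (block (suc N) c b ++ π′)              ≡⟨ weight-ofSize π′ (block-ofSize (suc N) c b) ⟩
    length (block (suc N) c b) * suc N + weight π′ ≡⟨ cong (λ k → k * suc N + weight π′) (length-block (suc N) c b) ⟩
    c * suc N + weight π′                        ≡⟨ cong (_+ weight π′) c*s≡ ⟩
    n ∸ weight π′ + weight π′                    ≡⟨ ℕ.m∸n+n≡m i≤n ⟩
    n                                            ∎)
  where open ≡-Reasoning

respects-tail : ∀ {r σ N c b π} → Respects r σ (suc N) (block (suc N) c b ++ π) → Respects r σ N π
respects-tail {r} {σ} {N} {c} {b} {π} resp t 1≤t t≤N =
  subst₂ (λ h k → h ∈ flags r (σ t) k) (hasOverlined-ofSize-≢ π (block-ofSize (suc N) c b) 1+N≢t)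
    (countSize-ofSize-≢ π (block-ofSize (suc N) c b) 1+N≢t) (resp t 1≤t (ℕ.m≤n⇒m≤1+n t≤N))
  where
  1+N≢t : suc N ≢ t
  1+N≢t = ℕ.>⇒≢ (s≤s t≤N)

admissible-complete : ∀ r σ N n π → IsAdmissible r σ N n π → π ∈ admissible r σ N n
admissible-complete r σ zero n [] (_ , _ , _ , refl) = here refl
admissible-complete r σ zero n ((s , b) ∷ π) ((pos , _) , (s≤0 ∷ _) , _ , _) = contradiction (ℕ.≤-trans (proj₁ pos) s≤0) λ ()
admissible-complete r σ (suc N) .(weight π) π (ov , π≤1+N , resp , refl) with decompose N π ov π≤1+N
... | c , b , π′ , refl , ov′ , π′≤N = subst (_∈ admissible r σ (suc N) n) (cong (_++ π′) (sym same-block))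
  (∈-admissible-suc⁺ (subst (weight π′ ≤_) (sym n≡) (ℕ.m≤n+m (weight π′) (c * suc N)))
    (∈-blocksOfWeight⁺ {r} {σ (suc N)} (s≤s z≤n) c*s≡
      (subst (λ k → b′ ∈ flags r (σ (suc N)) k) count (resp (suc N) (s≤s z≤n) ℕ.≤-refl)))
    (admissible-complete r σ N (weight π′) π′ (ov′ , π′≤N , respects-tail {r} {σ} {N} {c} {b} resp , refl)))
  where
  sizes = block-ofSize (suc N) c b
  n = weight (block (suc N) c b ++ π′)
  b′ = hasOverlined (suc N) (block (suc N) c b ++ π′)
  same-block : block (suc N) c b ≡ block (suc N) c b′
  same-block = block-flag (suc N) c b π′ (hasOverlined-beyond π′≤N (ℕ.n<1+n N))
  count : countSize (suc N) (block (suc N) c b ++ π′) ≡ c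
  count = trans (countSize-ofSize π′ sizes)
    (trans (cong₂ _+_ (length-block (suc N) c b) (countSize-beyond π′≤N (ℕ.n<1+n N))) (ℕ.+-identityʳ c))
  n≡ : n ≡ c * suc N + weight π′
  n≡ = trans (weight-ofSize π′ sizes) (cong (λ k → k * suc N + weight π′) (length-block (suc N) c b))
  c*s≡ : c * suc N ≡ n ∸ weight π′
  c*s≡ = sym (trans (cong (_∸ weight π′) n≡) (ℕ.m+n∸n≡m (c * suc N) (weight π′)))

unique-blocksOfWeight : ∀ r κ s m → Unique (blocksOfWeight r κ s m)
unique-blocksOfWeight r κ s m = unique-concatMap (blocksOfSize r κ s m) (Unique.upTo⁺ (suc m))
  (λ {c} _ → unique-if (c * s ≡ᵇ m) (unique-blocks r κ s c))
  (λ {c} {c′} _ _ β∈ β∈′ → trans (sym (length-of c β∈)) (length-of c′ β∈′))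
  where
  length-of : ∀ c {β} → β ∈ blocksOfSize r κ s m c → length β ≡ c
  length-of c β∈ with ∈-map⁻ (block s c) (proj₂ (∈-if⁻ (c * s ≡ᵇ m) β∈))
  ... | b , _ , refl = length-block s c b

dropSize-∈-withBlocks : ∀ {r κ N m π y} → PartsAtMost N π → y ∈ withBlocks r κ (suc N) m π →
                    dropSize (suc N) y ≡ π
dropSize-∈-withBlocks {r} {κ} {N} {m} {π} π≤N y∈ with ∈-map⁻ (_++ π) y∈
... | β , β∈ , refl with ∈-blocksOfWeight⁻ {r} {κ} {suc N} {m} β∈
...   | c , b , _ , _ , refl = dropSize-ofSize (block-ofSize (suc N) c b) π≤N

admissible-unique : ∀ r σ N n → 1 ≤ r → Unique (admissible r σ N n)
admissible-unique r σ zero zero _ = [] ∷ []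
admissible-unique r σ zero (suc n) _ = []
admissible-unique r σ (suc N) n 1≤r = unique-concatMap (extensions r σ N n) (Unique.upTo⁺ (suc n))
  (λ {i} _ → unique-concatMap (withBlocks r κ (suc N) (n ∸ i)) (admissible-unique r σ N i 1≤r)
    (λ _ → Unique.map⁺ (λ {β} {β′} → List.++-cancelʳ _ β β′) (unique-blocksOfWeight r κ (suc N) (n ∸ i)))
    (λ {π′} {π″} π′∈ π″∈ y∈ y∈′ → trans (sym (dropSize-∈-withBlocks {r} {κ} {N} {n ∸ i} (tail-parts π′∈) y∈))
                                        (dropSize-∈-withBlocks {r} {κ} {N} {n ∸ i} (tail-parts π″∈) y∈′)))
  (λ {i} {i′} _ _ y∈ y∈′ → trans (sym (weight-of i y∈)) (weight-of i′ y∈′))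
  where
  κ = σ (suc N)
  tail-parts : ∀ {i π′} → π′ ∈ admissible r σ N i → PartsAtMost N π′
  tail-parts {i} {π′} π′∈ = proj₁ (proj₂ (admissible-sound r σ N i π′ 1≤r π′∈))
  weight-of : ∀ i {y} → y ∈ extensions r σ N n i → weight (dropSize (suc N) y) ≡ i
  weight-of i y∈ with ∈-concatMap⁻′ (withBlocks r κ (suc N) (n ∸ i)) y∈
  ... | π′ , π′∈ , y∈′ = trans (cong weight (dropSize-∈-withBlocks {r} {κ} {N} {n ∸ i} (tail-parts π′∈) y∈′))
                               (proj₂ (proj₂ (proj₂ (admissible-sound r σ N i π′ 1≤r π′∈))))

demote : Restriction → Restriction
demote overlined = plain
demote κ = κ

-- profile A a k: the sizes a + iA with i < k − 1 are plain, a + (k − 1)A is overlined, all others free.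
profile : ℕ → ℕ → ℕ → Profile
profile A a zero s = free
profile A a (suc k) s = if s ≡ᵇ a + k * A then overlined else demote (profile A a k s)

flagCount-free : ∀ r c → flagCount r free c ≡ overlineChoices c
flagCount-free r zero = refl
flagCount-free r (suc c) = refl

flagCount-overlined : ∀ r c → flagCount r overlined c ≡ atLeast r c
flagCount-overlined r c with r ≤ᵇ c
... | true = refl
... | false = refl

flagCount-demote : ∀ r κ c → flagCount r (demote κ) c ≡ flagCount r κ c
flagCount-demote r free c = refl
flagCount-demote r plain c = refl
flagCount-demote r overlined c with r ≤ᵇ c
... | true = refl
... | false = refl

progression-injective : ∀ A a {i j} → 1 ≤ A → a + i * A ≡ a + j * A → i ≡ j
progression-injective A a {i} {j} 1≤A eq = ℕ.*-cancelʳ-≡ i j A (ℕ.+-cancelˡ-≡ a _ _ eq)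
  where instance _ = >-nonZero 1≤A

profile-free : ∀ A a K s → (∀ i → i < K → s ≢ a + i * A) → profile A a K s ≡ free
profile-free A a zero s _ = refl
profile-free A a (suc K) s off
  rewrite ≡ᵇ-false (off K (ℕ.n<1+n K)) | profile-free A a K s (λ i i<K → off i (ℕ.m<n⇒m<1+n i<K)) = refl

exponent : ℕ → ℕ → ℕ → ℕ
exponent A a k = A * (k C 2) + k * a

exponent-suc : ∀ A a k → exponent A a (suc k) ≡ exponent A a k + (a + k * A)
exponent-suc A a k = begin
  A * (suc k C 2) + suc k * a         ≡⟨ cong (λ x → A * x + suc k * a) (sym (nCk+nC[k+1]≡[n+1]C[k+1] k 1)) ⟩
  A * (k C 1 + k C 2) + suc k * a     ≡⟨ cong (λ x → A * (x + k C 2) + suc k * a) (nC1≡n k) ⟩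
  A * (k + k C 2) + suc k * a         ≡⟨ rearrange A a k (k C 2) ⟩
  A * (k C 2) + k * a + (a + k * A)   ∎
  where
  open ≡-Reasoning
  rearrange : ∀ A a k x → A * (k + x) + suc k * a ≡ A * x + k * a + (a + k * A)
  rearrange = ℕ-solve-∀

summand-zero : ∀ r A a → summand r A a 0 ≈ one
summand-zero r A a = ≈-trans (⊛-congʳ one (mono-cong r*0≡0)) (⊛-identityˡ one)
  where r*0≡0 = trans (cong (λ x → r * (x + 0)) (ℕ.*-zeroʳ A)) (ℕ.*-zeroʳ r)

summand-suc : ∀ r A a k → let t = a + k * A in
              summand r A a (suc k) ≈ summand r A a k ⊛ (mono (r * t) ⊛ geomInv -1ℤ t)
summand-suc r A a k = begin
  mono (r * exponent A a (suc k)) ⊛ (I ⊛ H)               ≈⟨ ⊛-congʳ (I ⊛ H) (mono-cong exponent≡) ⟩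
  mono (r * exponent A a k + r * t) ⊛ (I ⊛ H)             ≈⟨ ⊛-congʳ (I ⊛ H) (mono-+ (r * exponent A a k) (r * t)) ⟩
  (mono (r * exponent A a k) ⊛ mono (r * t)) ⊛ (I ⊛ H)    ≈⟨ interchange (mono (r * exponent A a k)) (mono (r * t)) I H ⟩
  (mono (r * exponent A a k) ⊛ I) ⊛ (mono (r * t) ⊛ H)    ∎
  where
  open ≈-Reasoning
  t = a + k * A
  I = invPoch A a k
  H = geomInv -1ℤ t
  exponent≡ = trans (cong (r *_) (exponent-suc A a k)) (ℕ.*-distribˡ-+ r (exponent A a k) t)

admissibleGF-profile : ∀ r A a K N → 1 ≤ A → 1 ≤ a → (∀ i → i < K → a + i * A ≤ N) →
  admissibleGF r (profile A a K) N ≈ prodFrom1To N overFactor ⊛ summand r A a K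
admissibleGF-profile r A a zero N _ _ _ = begin
  admissibleGF r (profile A a zero) N     ≈⟨ prodFrom1To-cong N (λ s 1≤s _ → free-factor s 1≤s) ⟩
  prodFrom1To N overFactor                ≈⟨ ⊛-identityʳ _ ⟨
  prodFrom1To N overFactor ⊛ one          ≈⟨ ⊛-congˡ (prodFrom1To N overFactor) (summand-zero r A a) ⟨
  prodFrom1To N overFactor ⊛ summand r A a zero ∎
  where
  open ≈-Reasoning
  free-factor : ∀ s → 1 ≤ s → dilate s (flagCount r free) ≈ overFactor s
  free-factor s 1≤s = ≈-trans (dilate-cong s (flagCount-free r)) (dilate-overlineChoices s 1≤s)
admissibleGF-profile r A a (suc K) N 1≤A 1≤a on-range = begin
  admissibleGF r (profile A a (suc K)) N               ≈⟨ prodFrom1To-extract N t R 1≤t (on-range K (ℕ.n<1+n K)) off-t at-t ⟩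
  admissibleGF r (profile A a K) N ⊛ R                 ≈⟨ ⊛-congʳ R (admissibleGF-profile r A a K N 1≤A 1≤a
                                                            (λ i i<K → on-range i (ℕ.m<n⇒m<1+n i<K))) ⟩
  (prodFrom1To N overFactor ⊛ summand r A a K) ⊛ R     ≈⟨ ⊛-assoc (prodFrom1To N overFactor) (summand r A a K) R ⟩
  prodFrom1To N overFactor ⊛ (summand r A a K ⊛ R)     ≈⟨ ⊛-congˡ (prodFrom1To N overFactor) (summand-suc r A a K) ⟨
  prodFrom1To N overFactor ⊛ summand r A a (suc K)     ∎
  where
  open ≈-Reasoning
  t = a + K * A
  R = mono (r * t) ⊛ geomInv -1ℤ t
  1≤t : 1 ≤ t
  1≤t = ℕ.≤-trans 1≤a (ℕ.m≤m+n a (K * A))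
  off-t : ∀ s → 1 ≤ s → s ≤ N → s ≢ t →
          dilate s (flagCount r (profile A a (suc K) s)) ≈ dilate s (flagCount r (profile A a K s))
  off-t s _ _ s≢t rewrite ≡ᵇ-false s≢t = dilate-cong s (flagCount-demote r (profile A a K s))
  t-free : profile A a K t ≡ free
  t-free = profile-free A a K t (λ i i<K t≡ → ℕ.<⇒≢ i<K (sym (progression-injective A a 1≤A t≡)))
  at-t : dilate t (flagCount r (profile A a (suc K) t)) ≈ dilate t (flagCount r (profile A a K t)) ⊛ R
  at-t rewrite ≡ᵇ-true {t} refl | t-free = begin
    dilate t (flagCount r overlined)      ≈⟨ dilate-cong t (flagCount-overlined r) ⟩
    dilate t (atLeast r)                  ≈⟨ dilate-atLeast≈overFactor-⊛ r t 1≤t ⟩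
    overFactor t ⊛ R                      ≈⟨ ⊛-congʳ R (≈-trans (dilate-cong t (flagCount-free r)) (dilate-overlineChoices t 1≤t)) ⟨
    dilate t (flagCount r free) ⊛ R       ∎

minimal-witness : ∀ {P : ℕ → Set} → Decidable P → ∀ {b} → P b → ∃ λ j → j ≤ b × P j × (∀ i → i < j → ¬ P i)
minimal-witness {P} P? {b} Pb = search b 0 refl (λ _ ())
  where
  search : ∀ k i → i + k ≡ b → (∀ j → j < i → ¬ P j) → ∃ λ j → j ≤ b × P j × (∀ i → i < j → ¬ P i)
  search k i i+k≡b below with P? i
  ... | yes Pi = i , subst (i ≤_) i+k≡b (ℕ.m≤m+n i k) , Pi , below
  search zero i i+0≡b below | no ¬Pi = contradiction (subst P (trans (sym i+0≡b) (ℕ.+-identityʳ i)) Pb) ¬Pi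
  search (suc k) i i+1+k≡b below | no ¬Pi = search k (suc i) (trans (sym (ℕ.+-suc i k)) i+1+k≡b) below′
    where
    below′ : ∀ j → j < suc i → ¬ P j
    below′ j j<1+i with j ℕ.≟ i
    ... | yes refl = ¬Pi
    ... | no j≢i = below j (ℕ.≤∧≢⇒< (ℕ.≤-pred j<1+i) j≢i)

∈⇒hasOverlined : ∀ {t} π → (t , true) ∈ π → hasOverlined t π ≡ true
∈⇒hasOverlined {t} (_ ∷ π) (here refl) rewrite ≡ᵇ-true {t} refl = refl
∈⇒hasOverlined {t} ((s , b) ∷ π) (there t∈π) with s ≡ᵇ t
... | true = trans (cong (b ∨_) (∈⇒hasOverlined π t∈π)) (Bool.∨-zeroʳ b)
... | false = ∈⇒hasOverlined π t∈π

hasOverlined⇒∈ : ∀ {t} π → hasOverlined t π ≡ true → (t , true) ∈ π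
hasOverlined⇒∈ {t} ((s , b) ∷ π) h with s ≡ᵇ t in s≡ᵇt
hasOverlined⇒∈ {t} ((s , true) ∷ π) h | true = here (cong (_, true) (sym (≡ᵇ-true⁻ s≡ᵇt)))
hasOverlined⇒∈ {t} ((s , false) ∷ π) h | true = there (hasOverlined⇒∈ π h)
... | false = there (hasOverlined⇒∈ π h)

hasOverlined-absent : ∀ t π → countSize t π ≡ 0 → hasOverlined t π ≡ false
hasOverlined-absent t [] _ = refl
hasOverlined-absent t ((s , b) ∷ π) none with s ≡ᵇ t
... | false = hasOverlined-absent t π none

partsAtMost-weight : ∀ π → PartsAtMost (weight π) π
partsAtMost-weight [] = []
partsAtMost-weight ((s , b) ∷ π) =
  ℕ.m≤m+n s (weight π) ∷ All.map (λ t≤w → ℕ.≤-trans t≤w (ℕ.m≤n+m (weight π) s)) (partsAtMost-weight π)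

hasOverlined⇒≤weight : ∀ {t} π → hasOverlined t π ≡ true → t ≤ weight π
hasOverlined⇒≤weight π h = All.lookup (partsAtMost-weight π) (hasOverlined⇒∈ π h)

positive-∈ : ∀ {π t b} → Positive π → (t , b) ∈ π → 1 ≤ t
positive-∈ {_ ∷ _} (1≤t , _) (here refl) = 1≤t
positive-∈ {_ ∷ π} (_ , pos) (there t∈π) = positive-∈ {π} pos t∈π

flags-free⁺ : ∀ r c {b} → (c ≡ 0 → b ≡ false) → b ∈ flags r free c
flags-free⁺ r zero b≡false rewrite b≡false refl = here refl
flags-free⁺ r (suc c) {false} _ = here refl
flags-free⁺ r (suc c) {true} _ = there (here refl)

flags-plain⁺ : ∀ {r c} → r ≤ c → false ∈ flags r plain c
flags-plain⁺ r≤c rewrite ≤ᵇ-true r≤c = here refl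

flags-overlined⁺ : ∀ {r c} → r ≤ c → true ∈ flags r overlined c
flags-overlined⁺ r≤c rewrite ≤ᵇ-true r≤c = here refl

flags-plain⁻ : ∀ {r c b} → b ∈ flags r plain c → r ≤ c × b ≡ false
flags-plain⁻ {r} {c} b∈ with r ≤ᵇ c in r≤ᵇc
flags-plain⁻ (here refl) | true = ≤ᵇ-true⁻ r≤ᵇc , refl

flags-overlined⁻ : ∀ {r c b} → b ∈ flags r overlined c → r ≤ c × b ≡ true
flags-overlined⁻ {r} {c} b∈ with r ≤ᵇ c in r≤ᵇc
flags-overlined⁻ (here refl) | true = ≤ᵇ-true⁻ r≤ᵇc , refl

progression-term : ∀ A a {m} .{{_ : NonZero A}} → 1 ≤ a → a ≤ A → 1 ≤ m → m % A ≡ a % A → ∃ λ i → m ≡ a + i * A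
progression-term A a {m} 1≤a a≤A 1≤m m≡a with ℕ.m≤n⇒m<n∨m≡n a≤A
... | inj₁ a<A = m / A , trans (DivMod.m≡m%n+[m/n]*n m A) (cong (_+ m / A * A) (trans m≡a (DivMod.m<n⇒m%n≡m a<A)))
... | inj₂ refl with m / A | DivMod.m≡m%n+[m/n]*n m a
...   | zero | m≡ = contradiction (trans m≡ (cong (_+ 0) (trans m≡a (DivMod.n%n≡0 a)))) (ℕ.>⇒≢ 1≤m)
...   | suc q | m≡ = q , trans m≡ (cong (_+ (a + q * a)) (trans m≡a (DivMod.n%n≡0 a)))

progression-mod : ∀ A a i .{{_ : NonZero A}} → (a + i * A) % A ≡ a % A
progression-mod A a i = DivMod.[m+kn]%n≡m%n a i A

progression-mono-≤ : ∀ A a {i j} → i ≤ j → a + i * A ≤ a + j * A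
progression-mono-≤ A a i≤j = ℕ.+-monoʳ-≤ a (ℕ.*-monoˡ-≤ A i≤j)

progression-mono-< : ∀ A a {i j} .{{_ : NonZero A}} → i < j → a + i * A < a + j * A
progression-mono-< A a i<j = ℕ.+-monoʳ-< a (ℕ.*-monoˡ-< A i<j)

progression-cancel-< : ∀ A a {i j} → a + i * A < a + j * A → i < j
progression-cancel-< A a {i} {j} lt = ℕ.≰⇒> (λ j≤i → ℕ.<⇒≱ lt (progression-mono-≤ A a j≤i))

progression-> : ∀ A a k → 1 ≤ a → 1 ≤ A → k < a + k * A
progression-> A a k 1≤a 1≤A = ℕ.+-mono-≤ 1≤a (subst (_≤ k * A) (ℕ.*-identityʳ k) (ℕ.*-monoʳ-≤ k 1≤A))

profile-overlined-at : ∀ A a k → profile A a (suc k) (a + k * A) ≡ overlined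
profile-overlined-at A a k rewrite ≡ᵇ-true {a + k * A} refl = refl

profile-plain-at : ∀ A a {k i} → 1 ≤ A → i < k → profile A a (suc k) (a + i * A) ≡ plain
profile-plain-at A a {suc k} {i} 1≤A i<1+k
  rewrite ≡ᵇ-false (ℕ.<⇒≢ i<1+k ∘ progression-injective A a 1≤A) with i ℕ.≟ k
... | yes refl rewrite profile-overlined-at A a i = refl
... | no i≢k rewrite profile-plain-at A a 1≤A (ℕ.≤∧≢⇒< (ℕ.≤-pred i<1+k) i≢k) = refl

profile-overlined⁻ : ∀ A a k s → profile A a (suc k) s ≡ overlined → s ≡ a + k * A
profile-overlined⁻ A a k s eq with s ≡ᵇ a + k * A in s≡ᵇ
... | true = ≡ᵇ-true⁻ s≡ᵇ
... | false with profile A a k s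
...   | free = contradiction eq λ ()
...   | plain = contradiction eq λ ()
...   | overlined = contradiction eq λ ()

profile-plain⁻ : ∀ A a K s → profile A a K s ≡ plain → ∃ λ i → suc i < K × s ≡ a + i * A
profile-plain⁻ A a (suc k) s eq with s ≡ᵇ a + k * A
... | true = contradiction eq λ ()
... | false with profile A a k s in eq′
...   | plain = let i , 1+i<k , s≡ = profile-plain⁻ A a k s eq′ in i , ℕ.m<n⇒m<1+n 1+i<k , s≡
...   | overlined with k
...     | suc k′ = k′ , ℕ.≤-refl , profile-overlined⁻ A a k′ s eq′

respects-at : ∀ {r σ N π t κ} → Respects r σ N π → 1 ≤ t → t ≤ N → σ t ≡ κ →
              hasOverlined t π ∈ flags r κ (countSize t π)
respects-at resp 1≤t t≤N refl = resp _ 1≤t t≤N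

condition⇒respects : ∀ r A a π .{{_ : NonZero A}} → 1 ≤ a → a ≤ A → IsOverpartition π → Condition r A a π →
  ∃ λ k → a + k * A ≤ weight π × Respects r (profile A a (suc k)) (weight π) π
condition⇒respects r A a π 1≤a a≤A (pos , _) (m , (_ , _ , _ , below-mes) , s , s∈π , s≡a , s<m)
  with progression-term A a 1≤a a≤A (positive-∈ {π} pos s∈π) s≡a
... | j , refl with minimal-witness (λ i → hasOverlined (a + i * A) π Bool.≟ true) {j} (∈⇒hasOverlined π s∈π)
...   | k , k≤j , overlined-k , below-k = k , hasOverlined⇒≤weight π overlined-k , respects
  where
  full : ∀ i → i ≤ k → r ≤ countSize (a + i * A) π
  full i i≤k = below-mes (a + i * A) (ℕ.≤-trans 1≤a (ℕ.m≤m+n a (i * A))) (progression-mod A a i)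
                 (ℕ.≤-<-trans (progression-mono-≤ A a (ℕ.≤-trans i≤k k≤j)) s<m)
  respects : Respects r (profile A a (suc k)) (weight π) π
  respects t _ _ with profile A a (suc k) t in eq
  ... | free = flags-free⁺ r _ (hasOverlined-absent t π)
  ... | plain with profile-plain⁻ A a (suc k) t eq
  ...   | i , 1+i<1+k , refl rewrite ¬-not (below-k i (ℕ.≤-pred 1+i<1+k)) = flags-plain⁺ (full i (ℕ.<⇒≤ (ℕ.≤-pred 1+i<1+k)))
  respects t _ _ | overlined with profile-overlined⁻ A a k t eq
  ...   | refl rewrite overlined-k = flags-overlined⁺ (full k ℕ.≤-refl)

respects⇒condition : ∀ r A a π k .{{_ : NonZero A}} → 1 ≤ a → a ≤ A → 1 ≤ r → a + k * A ≤ weight π →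
  Respects r (profile A a (suc k)) (weight π) π → Condition r A a π
respects⇒condition r A a π k 1≤a a≤A 1≤r k-in-range resp
  with minimal-witness (λ J → countSize (a + J * A) π ℕ.<? r) {weight π} sparse-beyond
  where
  sparse-beyond : countSize (a + weight π * A) π < r
  sparse-beyond = subst (_< r) (sym (countSize-beyond (partsAtMost-weight π)
                                      (progression-> A a (weight π) 1≤a (>-nonZero⁻¹ A)))) 1≤r
... | J , _ , sparse-J , below-J =
  a + J * A , (ℕ.≤-trans 1≤a (ℕ.m≤m+n a (J * A)) , progression-mod A a J , sparse-J , below-mes) ,
  a + k * A , hasOverlined⇒∈ π (proj₂ (flags-overlined⁻ {r} at-k)) , progression-mod A a k , progression-mono-< A a k<J
  where
  in-range : ∀ i → i ≤ k → 1 ≤ a + i * A × a + i * A ≤ weight π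
  in-range i i≤k = ℕ.≤-trans 1≤a (ℕ.m≤m+n a (i * A)) , ℕ.≤-trans (progression-mono-≤ A a i≤k) k-in-range
  at-k = respects-at {r} {profile A a (suc k)} {weight π} {π} resp
           (proj₁ (in-range k ℕ.≤-refl)) k-in-range (profile-overlined-at A a k)
  full : ∀ i → i ≤ k → r ≤ countSize (a + i * A) π
  full i i≤k with i ℕ.≟ k
  ... | yes refl = proj₁ (flags-overlined⁻ {r} at-k)
  ... | no i≢k = proj₁ (flags-plain⁻ {r} (respects-at {r} {profile A a (suc k)} {weight π} {π} resp
                                           (proj₁ (in-range i i≤k)) (proj₂ (in-range i i≤k))
                                        (profile-plain-at A a (>-nonZero⁻¹ A) (ℕ.≤∧≢⇒< i≤k i≢k))))
  k<J : k < J
  k<J = ℕ.≰⇒> (λ J≤k → ℕ.<⇒≱ sparse-J (full J J≤k))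
  below-mes : ∀ m′ → 1 ≤ m′ → m′ % A ≡ a % A → m′ < a + J * A → r ≤ countSize m′ π
  below-mes m′ 1≤m′ m′≡a m′<m with progression-term A a 1≤a a≤A 1≤m′ m′≡a
  ... | i , refl = ℕ.≮⇒≥ (below-J i (progression-cancel-< A a m′<m))

summand-low : ∀ r A a k {m} → m < r * exponent A a k → summand r A a k m ≡ + 0
summand-low r A a k = mono-⊛-< (r * exponent A a k) (invPoch A a k)

index≤exponent : ∀ A a k r → 1 ≤ a → 1 ≤ r → k ≤ r * exponent A a k
index≤exponent A a k r 1≤a 1≤r = begin
  k                     ≤⟨ ℕ.m≤m*n k a ⟩
  k * a                 ≤⟨ ℕ.m≤n+m (k * a) (A * (k C 2)) ⟩
  exponent A a k        ≤⟨ ℕ.m≤n*m (exponent A a k) r ⟩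
  r * exponent A a k    ∎
  where
  open ℕ.≤-Reasoning
  instance
    _ = >-nonZero 1≤a
    _ = >-nonZero 1≤r

⊛-coeff-zero : ∀ X Y n → (∀ m → m ≤ n → Y m ≡ + 0) → (X ⊛ Y) n ≡ + 0
⊛-coeff-zero X Y n Y≡0 = trans (sumTo≡sumBelow n _) (sumBelow-zero (suc n) (λ i _ →
  trans (cong (X i *ᶻ_) (Y≡0 (n ∸ i) (ℕ.m∸n≤m n i))) (ℤ.*-zeroʳ (X i))))

-- Only the summands with k ≤ n contribute to the coefficient of q^n, since the k-th has order ≥ k.
rhs-as-sum : ∀ r A a n → 1 ≤ r → 1 ≤ a → rhs r A a n ≡ sumBelow n (λ k → (overGF ⊛ summand r A a (suc k)) n)
rhs-as-sum r A a n 1≤r 1≤a = begin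
  rhs r A a n
    ≡⟨ sumTo-cong n (λ i _ → cong (overGF i *ᶻ_) (truncated i)) ⟩
  sumTo n (λ i → overGF i *ᶻ sumBelow n (λ k → summand r A a (suc k) (n ∸ i)))
    ≡⟨ sumTo-cong n (λ i _ → sumBelow-*ˡ n (overGF i) _) ⟩
  sumTo n (λ i → sumBelow n (λ k → overGF i *ᶻ summand r A a (suc k) (n ∸ i)))
    ≡⟨ sumTo≡sumBelow n _ ⟩
  sumBelow (suc n) (λ i → sumBelow n (λ k → overGF i *ᶻ summand r A a (suc k) (n ∸ i)))
    ≡⟨ sumBelow-swap (suc n) n _ ⟩
  sumBelow n (λ k → sumBelow (suc n) (λ i → overGF i *ᶻ summand r A a (suc k) (n ∸ i)))
    ≡⟨ sumBelow-cong n (λ k _ → sumTo≡sumBelow n _) ⟨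
  sumBelow n (λ k → (overGF ⊛ summand r A a (suc k)) n)
    ∎
  where
  open ≡-Reasoning
  truncated : ∀ i → sumSeries r A a (n ∸ i) ≡ sumBelow n (λ k → summand r A a (suc k) (n ∸ i))
  truncated i = trans (sumFrom1To≡sumBelow (n ∸ i) _) (sym (sumBelow-extend n _ (ℕ.m∸n≤m n i) (λ k n∸i≤k _ →
    summand-low r A a (suc k) (ℕ.<-≤-trans (s≤s n∸i≤k) (index≤exponent A a (suc k) r 1≤a 1≤r)))))

-- The overpartitions of n whose smallest overlined part of size ≡ a (mod A) below mes is a + kA.
conditionListAt : ℕ → ℕ → ℕ → ℕ → ℕ → List (List Part)
conditionListAt r A a n k = if a + k * A ≤ᵇ n then admissible r (profile A a (suc k)) n n else []

conditionList : ℕ → ℕ → ℕ → ℕ → List (List Part)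
conditionList r A a n = concatMap (conditionListAt r A a n) (upTo n)

∈-conditionList⁻ : ∀ {r A a n π} → π ∈ conditionList r A a n →
  ∃ λ k → a + k * A ≤ n × π ∈ admissible r (profile A a (suc k)) n n
∈-conditionList⁻ {r} {A} {a} {n} π∈ with ∈-concatMap⁻′ (conditionListAt r A a n) {upTo n} π∈
... | k , _ , π∈k = let in-range , π∈′ = ∈-if⁻ (a + k * A ≤ᵇ n) π∈k in k , ≤ᵇ-true⁻ in-range , π∈′

-- The overlined part a + kA is plain for every larger index.
profile-index-unique : ∀ r A a n π {k k′} → 1 ≤ r → 1 ≤ a → 1 ≤ A → k < k′ → a + k′ * A ≤ n →
  π ∈ admissible r (profile A a (suc k)) n n → ¬ π ∈ admissible r (profile A a (suc k′)) n n
profile-index-unique r A a n π {k} {k′} 1≤r 1≤a 1≤A k<k′ k′-in-range π∈ π∈′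
  with admissible-sound r _ n n π 1≤r π∈ | admissible-sound r _ n n π 1≤r π∈′
... | _ , _ , resp , _ | _ , _ , resp′ , _ = contradiction (trans (sym is-overlined) is-plain) λ ()
  where
  1≤t = ℕ.≤-trans 1≤a (ℕ.m≤m+n a (k * A))
  t≤n = ℕ.≤-trans (progression-mono-≤ A a (ℕ.<⇒≤ k<k′)) k′-in-range
  is-overlined = proj₂ (flags-overlined⁻ {r}
    (respects-at {r} {profile A a (suc k)} {n} {π} resp 1≤t t≤n (profile-overlined-at A a k)))
  is-plain = proj₂ (flags-plain⁻ {r}
    (respects-at {r} {profile A a (suc k′)} {n} {π} resp′ 1≤t t≤n (profile-plain-at A a 1≤A k<k′)))

unique-conditionList : ∀ r A a n → 1 ≤ r → 1 ≤ a → 1 ≤ A → Unique (conditionList r A a n)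
unique-conditionList r A a n 1≤r 1≤a 1≤A = unique-concatMap (conditionListAt r A a n) (Unique.upTo⁺ n)
  (λ {k} _ → unique-if (a + k * A ≤ᵇ n) (admissible-unique r _ n n 1≤r)) separate
  where
  separate : ∀ {k k′ π} → k ∈ upTo n → k′ ∈ upTo n →
             π ∈ conditionListAt r A a n k → π ∈ conditionListAt r A a n k′ → k ≡ k′
  separate {k} {k′} {π} _ _ π∈ π∈′ with ∈-if⁻ (a + k * A ≤ᵇ n) π∈ | ∈-if⁻ (a + k′ * A ≤ᵇ n) π∈′
  ... | in-range , π∈k | in-range′ , π∈k′ with ℕ.<-cmp k k′
  ...   | tri< k<k′ _ _ = contradiction π∈k′ (profile-index-unique r A a n π 1≤r 1≤a 1≤A k<k′ (≤ᵇ-true⁻ in-range′) π∈k)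
  ...   | tri≈ _ k≡k′ _ = k≡k′
  ...   | tri> _ _ k′<k = contradiction π∈k (profile-index-unique r A a n π 1≤r 1≤a 1≤A k′<k (≤ᵇ-true⁻ in-range) π∈k′)

conditionList-sound : ∀ r A a n π .{{_ : NonZero A}} → 1 ≤ a → a ≤ A → 1 ≤ r → π ∈ conditionList r A a n →
                      IsOverpartition π × weight π ≡ n × Condition r A a π
conditionList-sound r A a n π 1≤a a≤A 1≤r π∈ with ∈-conditionList⁻ {r} {A} {a} {n} π∈
... | k , in-range , π∈k with admissible-sound r _ n n π 1≤r π∈k
...   | ov , _ , resp , refl = ov , refl , respects⇒condition r A a π k 1≤a a≤A 1≤r in-range resp

conditionList-complete : ∀ r A a π .{{_ : NonZero A}} → 1 ≤ a → a ≤ A → IsOverpartition π → Condition r A a π →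
                         π ∈ conditionList r A a (weight π)
conditionList-complete r A a π 1≤a a≤A ov cond with condition⇒respects r A a π 1≤a a≤A ov cond
... | k , in-range , resp = ∈-concatMap⁺′ (conditionListAt r A a n)
  (∈-upTo⁺ (ℕ.<-≤-trans (progression-> A a k 1≤a (>-nonZero⁻¹ A)) in-range))
  (∈-if⁺ (≤ᵇ-true in-range) (admissible-complete r _ n n π (ov , partsAtMost-weight π , resp , refl)))
  where n = weight π

length-conditionList : ∀ r A a n → 1 ≤ r → 1 ≤ a → 1 ≤ A → + length (conditionList r A a n) ≡ rhs r A a n
length-conditionList r A a n 1≤r 1≤a 1≤A =
  trans (length-concatMap-upTo (conditionListAt r A a n) n)
        (trans (sumBelow-cong n (λ k _ → term k)) (sym (rhs-as-sum r A a n 1≤r 1≤a)))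
  where
  term : ∀ k → + length (conditionListAt r A a n k) ≡ (overGF ⊛ summand r A a (suc k)) n
  term k with a + k * A ℕ.≤? n
  ... | yes in-range rewrite ≤ᵇ-true in-range = begin
    + length (admissible r (profile A a (suc k)) n n)            ≡⟨ length-admissible r _ n n ⟩
    admissibleGF r (profile A a (suc k)) n n                     ≡⟨ admissibleGF-profile r A a (suc k) n 1≤A 1≤a
                                                                      (λ i i<1+k → ℕ.≤-trans (progression-mono-≤ A a (ℕ.≤-pred i<1+k)) in-range) n ⟩
    (prodFrom1To n overFactor ⊛ summand r A a (suc k)) n         ≡⟨ overGF-⊛-coeff n (summand r A a (suc k)) ⟩
    (overGF ⊛ summand r A a (suc k)) n                           ∎
    where open ≡-Reasoning
  ... | no out-of-range rewrite ≤ᵇ-false out-of-range = sym (⊛-coeff-zero overGF _ n (λ m m≤n →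
    summand-low r A a (suc k) (begin-strict
      m                              ≤⟨ m≤n ⟩
      n                              <⟨ ℕ.≰⇒> out-of-range ⟩
      a + k * A                      ≤⟨ ℕ.m≤n+m _ (exponent A a k) ⟩
      exponent A a k + (a + k * A)   ≡⟨ exponent-suc A a k ⟨
      exponent A a (suc k)           ≤⟨ ℕ.m≤n*m (exponent A a (suc k)) r ⟩
      r * exponent A a (suc k)       ∎)))
    where
    open ℕ.≤-Reasoning
    instance _ = >-nonZero 1≤r

corollary2p1 : (A a r : ℕ) .{{_ : NonZero A}} → 1 ≤ a → a ≤ A → 1 ≤ r →
    (n : ℕ) →
    ∃ λ (L : List (List Part)) →
      Unique L ×
      (∀ π → π ∈ L → IsOverpartition π × weight π ≡ n × Condition r A a π) ×
      (∀ π → IsOverpartition π → weight π ≡ n → Condition r A a π → π ∈ L) ×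
      (+ (length L) ≡ rhs r A a n)
corollary2p1 A a r 1≤a a≤A 1≤r n =
  conditionList r A a n ,
  unique-conditionList r A a n 1≤r 1≤a 1≤A ,
  (λ π → conditionList-sound r A a n π 1≤a a≤A 1≤r) ,
  (λ { π ov refl cond → conditionList-complete r A a π 1≤a a≤A ov cond }) ,
  length-conditionList r A a n 1≤r 1≤a 1≤A
  where 1≤A = >-nonZero⁻¹ A
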